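{- For every integer $n \ge 3$, we have $\chi'_{st}(C_5 \,\square\, P_n) = 6$ if $n \in \{3,4,5,6\}$, and $\chi'_{st}(C_5 \,\square\, P_n) = 7$ if $n \ge 7$.
   Context: A star edge-coloring of a graph $G$ is a proper edge-coloring of $G$ in which there is no bichromatic path and no bichromatic cycle of length four (i.e., with four edges). The star chromatic index $\chi'_{st}(G)$ is the minimum number of colors in a star edge-coloring of $G$. $C_m$ denotes the cycle on $m$ vertices and $P_n$ the path on $n$ vertices. $G \,\square\, H$ denotes the Cartesian product: vertex set $V(G)\times V(H)$, with $(u,v)(u',v')$ an edge iff either $uu'\in E(G)$ and $v=v'$, or $u=u'$ and $vv'\in E(H)$. -}

module Defs where

open import Data.Nat using (ℕ; suc; _≤_; _%_; NonZero)
open import Data.Fin using (Fin; toℕ)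
open import Data.Product using (_×_; _,_; Σ; proj₁; proj₂)
open import Data.Sum using (_⊎_)
open import Relation.Binary.PropositionalEquality using (_≡_; _≢_)
open import Relation.Nullary using (¬_)
open import Level using (0ℓ) renaming (suc to lsuc)

-- A graph: a vertex type with an adjacency relation (all graphs used below
-- are simple and undirected: their adjacency is symmetric and irreflexive).
record Graph : Set₁ where
  field
    V     : Set
    Adj   : V → V → Set
open Graph public

record EdgeColouring (G : Graph) (k : ℕ) : Set where
  field
    col     : (u v : V G) → Adj G u v → Fin k
    col-sym : ∀ u v (p : Adj G u v) (q : Adj G v u) → col u v p ≡ col v u q
open EdgeColouring public

Proper : (G : Graph) {k : ℕ} → EdgeColouring G k → Set
Proper G c = ∀ u v w (p : Adj G u v) (q : Adj G v w) → u ≢ w →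
  col c u v p ≢ col c v w q

-- star: no bichromatic path with four edges and no bichromatic 4-cycle.
-- A walk v0 v1 v2 v3 v4 with v0..v3 pairwise distinct and v1..v4 pairwise
-- distinct is either a path with 4 edges (v4 ≢ v0) or a 4-cycle (v4 ≡ v0).
-- It is bichromatic iff colour(v0v1) = colour(v2v3) and colour(v1v2) = colour(v3v4)
-- (in a proper colouring consecutive edges differ).
Star : (G : Graph) {k : ℕ} → EdgeColouring G k → Set
Star G c = ∀ v0 v1 v2 v3 v4
  (p01 : Adj G v0 v1) (p12 : Adj G v1 v2) (p23 : Adj G v2 v3) (p34 : Adj G v3 v4) →
  v0 ≢ v2 → v0 ≢ v3 → v1 ≢ v3 → v1 ≢ v4 → v2 ≢ v4 →
  ¬ (col c v0 v1 p01 ≡ col c v2 v3 p23 × col c v1 v2 p12 ≡ col c v3 v4 p34)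

StarEdgeColouring : Graph → ℕ → Set
StarEdgeColouring G k = Σ (EdgeColouring G k) λ c → Proper G c × Star G c

StarChromaticIndex : Graph → ℕ → Set
StarChromaticIndex G k =
  StarEdgeColouring G k × (∀ m → StarEdgeColouring G m → k ≤ m)

-- Cycle C_m on vertices Fin m (i ~ i+1 mod m); a simple graph for m ≥ 3.
data CycAdj (m : ℕ) .{{_ : NonZero m}} (i j : Fin m) : Set where
  fwd : toℕ j ≡ suc (toℕ i) % m → CycAdj m i j
  bwd : toℕ i ≡ suc (toℕ j) % m → CycAdj m i j

data PathAdj (n : ℕ) (i j : Fin n) : Set where
  fwd : toℕ j ≡ suc (toℕ i) → PathAdj n i j
  bwd : toℕ i ≡ suc (toℕ j) → PathAdj n i j

data BoxAdj (G H : Graph) : V G × V H → V G × V H → Set where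
  left  : ∀ {u u' v} → Adj G u u' → BoxAdj G H (u , v) (u' , v)
  right : ∀ {u v v'} → Adj H v v' → BoxAdj G H (u , v) (u , v')

Cycle : (m : ℕ) .{{_ : NonZero m}} → Graph
Cycle m = record { V = Fin m ; Adj = CycAdj m }

PathG : ℕ → Graph
PathG n = record { V = Fin n ; Adj = PathAdj n }

_□_ : Graph → Graph → Graph
G □ H = record { V = V G × V H ; Adj = BoxAdj G H }

{-# OPTIONS --safe #-}
module Submission where

-- Upper bounds come from two explicit tables: a star 6-edge-colouring of C₅ □ P₆ and a star
-- 7-edge-colouring of C₅ □ C₄.  The first restricts to C₅ □ Pₙ for n ≤ 6; the second is pulled
-- back along the covering C₅ □ Pₙ → C₅ □ C₄, j ↦ j mod 4, which identifies no two vertices of a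
-- walk of length at most 3, so bichromatic paths and 4-cycles are not created.
-- Lower bounds: restriction to C₅ □ P₃ and C₅ □ P₇ reduces them to the non-existence of a star
-- 5-edge-colouring of C₅ □ P₃ and of a star 6-edge-colouring of C₅ □ P₇.  Both are decided by an
-- exhaustive backtracking search over the colour sequence of a fixed enumeration of the edges,
-- naming colours in order of first appearance and, for C₅ □ P₇, keeping only colourings whose
-- equality pattern is lexicographically least under the dihedral symmetries of C₅.  The search
-- is proved complete; the constraints it propagates are supplied as a certificate whose every
-- entry is checked to come from a path or a 4-walk of the graph.

open import Defs
open import Data.Bool using (Bool; true; false; if_then_else_; _∧_; _∨_; not; T)
open import Data.Bool.Properties using (T-∧; T-∨)
open import Data.Empty using (⊥-elim)
open import Data.Fin using (Fin; toℕ; fromℕ<; inject≤; inject₁)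
import Data.Fin as Fin
open import Data.Fin.Properties
  using (toℕ<n; toℕ-fromℕ<; toℕ-injective; toℕ-inject≤; toℕ-inject₁; inject≤-injective; injective⇒≤)
  renaming (_≟_ to _≟ᶠ_)
open import Data.List
  using (List; []; _∷_; _++_; map; take; length; upTo; applyUpTo; filter; allFin; cartesianProduct)
open import Data.List.Membership.Propositional using (_∈_; _∉_)
open import Data.List.Membership.Propositional.Properties
  using (∈-filter⁺; ∈-allFin; ∈-cartesianProduct⁺; ∈-map⁺; ∈-map⁻; ∈-upTo⁺)
open import Data.List.Properties using (take-map; map-∘; map-applyUpTo; map-cong-local)
  renaming (≡-dec to ≡-dec-List)
open import Data.List.Relation.Binary.Lex.Strict
  using (Lex-≤; base; halt; this; next; ≤-decidable; ≤-decTotalOrder)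
open import Data.List.Relation.Unary.All as All using (All; []; _∷_; all?)
open import Data.List.Relation.Unary.All.Properties using (all-upTo)
open import Data.List.Relation.Unary.Any using (Any; here; there; any?)
open import Data.Nat
  using (ℕ; zero; suc; _+_; _*_; _∸_; _⊔_; _⊓_; _%_; _/_; _≤_; _<_; z≤n; s≤s; _<ᵇ_; _≡ᵇ_; NonZero)
open import Data.Nat.DivMod using (_mod_; m≡m%n+[m/n]*n; %-distribˡ-+; m<n⇒m%n≡m)
open import Data.Nat.Divisibility using (divides; ∣m+n∣m⇒∣n; n∣m*n; ∣⇒≤)
open import Data.Nat.Properties
  using ( _≟_; _<?_; _≤?_; ≤-refl; ≤-trans; ≤-reflexive; ≤-total; n≤1+n; ≤-<-trans; m<n⇒m<1+n; ≤∧≢⇒<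
        ; <⇒≢; <⇒≱; ≮⇒≥; m<1+n⇒m<n∨m≡n; +-assoc; +-comm; +-suc; +-identityʳ; +-cancelˡ-≡; +-monoʳ-≤
        ; +-∸-assoc; n∸n≡0; m+[n∸m]≡n; m≤n+o⇒m∸n≤o; m≤n⇒m⊔n≡n; m≥n⇒m⊔n≡m; anyUpTo?
        ; <-strictTotalOrder)
open import Data.List.Membership.DecPropositional _≟_ using (_∈?_)
open import Data.List.Membership.DecPropositional (≡-dec-List _≟_) using () renaming (_∈?_ to _∈ˡ?_)
open import Data.Product using (Σ; _×_; _,_; proj₁; proj₂; map₁; map₂)
open import Data.Product.Properties using () renaming (≡-dec to ≡-dec-×)
open import Data.Sum using (_⊎_; inj₁; inj₂; [_,_])
open import Data.Unit using (⊤; tt)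
open import Function using (id; _∘_; _⇔_; mk⇔; Equivalence)
open import Relation.Binary.Bundles using (DecTotalOrder)
open import Relation.Binary.Definitions using (DecidableEquality)
open import Relation.Binary.PropositionalEquality
  using (_≡_; _≢_; refl; sym; trans; cong; cong₂; subst; subst₂; module ≡-Reasoning)
open import Relation.Nullary using (¬_; Dec; yes; no; does)
open import Relation.Nullary.Decidable
  using (True; toWitness; map′; does-⇔; dec-true; dec-false; _×-dec_; _⊎-dec_; _→-dec_; ¬?; T?)

open import Data.List.Extrema (DecTotalOrder.totalOrder (≤-decTotalOrder <-strictTotalOrder))
  using (argmin; f[argmin]≤f[xs]; argmin-sel)

-- Finite graphs

cycle-reverse : ∀ {m} .{{_ : NonZero m}} {i j} → CycAdj m i j → CycAdj m j i
cycle-reverse (fwd e) = bwd e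
cycle-reverse (bwd e) = fwd e

path-reverse : ∀ {n i j} → PathAdj n i j → PathAdj n j i
path-reverse (fwd e) = bwd e
path-reverse (bwd e) = fwd e

□-reverse : ∀ {G H} → (∀ {u v} → Adj G u v → Adj G v u) → (∀ {u v} → Adj H u v → Adj H v u) →
            ∀ {x y} → Adj (G □ H) x y → Adj (G □ H) y x
□-reverse reverseG reverseH (left a)  = left (reverseG a)
□-reverse reverseG reverseH (right b) = right (reverseH b)

DecidableAdjacency : Graph → Set
DecidableAdjacency G = ∀ u v → Dec (Adj G u v)

cycle-adj? : ∀ m .{{_ : NonZero m}} → DecidableAdjacency (Cycle m)
cycle-adj? m i j =
  map′ [ fwd , bwd ] split ((toℕ j ≟ suc (toℕ i) % m) ⊎-dec (toℕ i ≟ suc (toℕ j) % m))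
  where
  split : CycAdj m i j → toℕ j ≡ suc (toℕ i) % m ⊎ toℕ i ≡ suc (toℕ j) % m
  split (fwd e) = inj₁ e
  split (bwd e) = inj₂ e

path-adj? : ∀ n → DecidableAdjacency (PathG n)
path-adj? n i j = map′ [ fwd , bwd ] split ((toℕ j ≟ suc (toℕ i)) ⊎-dec (toℕ i ≟ suc (toℕ j)))
  where
  split : PathAdj n i j → toℕ j ≡ suc (toℕ i) ⊎ toℕ i ≡ suc (toℕ j)
  split (fwd e) = inj₁ e
  split (bwd e) = inj₂ e

□-adj? : ∀ {G H} → DecidableEquality (V G) → DecidableEquality (V H) →
         DecidableAdjacency G → DecidableAdjacency H → DecidableAdjacency (G □ H)
□-adj? {G} {H} _≟G_ _≟H_ adjG? adjH? (u , v) (u′ , v′) =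
  map′ join split ((v ≟H v′ ×-dec adjG? u u′) ⊎-dec (u ≟G u′ ×-dec adjH? v v′))
  where
  join : (v ≡ v′ × Adj G u u′) ⊎ (u ≡ u′ × Adj H v v′) → BoxAdj G H (u , v) (u′ , v′)
  join (inj₁ (refl , a)) = left a
  join (inj₂ (refl , b)) = right b
  split : BoxAdj G H (u , v) (u′ , v′) → (v ≡ v′ × Adj G u u′) ⊎ (u ≡ u′ × Adj H v v′)
  split (left a)  = inj₁ (refl , a)
  split (right b) = inj₂ (refl , b)

record Embedding (G H : Graph) : Set where
  field
    vertexMap : V G → V H
    preserves : ∀ {u v} → Adj G u v → Adj H (vertexMap u) (vertexMap v)
    injective : ∀ {u v} → vertexMap u ≡ vertexMap v → u ≡ v
open Embedding public

idᵉ : ∀ {G} → Embedding G G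
idᵉ = record { vertexMap = id ; preserves = id ; injective = id }

_∘ᵉ_ : ∀ {G H K} → Embedding H K → Embedding G H → Embedding G K
e ∘ᵉ f = record
  { vertexMap = vertexMap e ∘ vertexMap f
  ; preserves = preserves e ∘ preserves f
  ; injective = injective f ∘ injective e
  }

_^ᵉ_ : ∀ {G} → Embedding G G → ℕ → Embedding G G
e ^ᵉ zero  = idᵉ
e ^ᵉ suc t = e ∘ᵉ (e ^ᵉ t)

□-embedding₁ : ∀ {G G′ H} → Embedding G G′ → Embedding (G □ H) (G′ □ H)
□-embedding₁ e = record
  { vertexMap = map₁ (vertexMap e)
  ; preserves = λ { (left a) → left (preserves e a) ; (right b) → right b }
  ; injective = λ eq → cong₂ _,_ (injective e (cong proj₁ eq)) (cong proj₂ eq)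
  }

□-embedding₂ : ∀ {G H H′} → Embedding H H′ → Embedding (G □ H) (G □ H′)
□-embedding₂ e = record
  { vertexMap = map₂ (vertexMap e)
  ; preserves = λ { (left a) → left a ; (right b) → right (preserves e b) }
  ; injective = λ eq → cong₂ _,_ (cong proj₁ eq) (injective e (cong proj₂ eq))
  }

path-embedding : ∀ {n N} → n ≤ N → Embedding (PathG n) (PathG N)
path-embedding {n} {N} n≤N = record
  { vertexMap = inject
  ; preserves = preserves′
  ; injective = inject≤-injective n≤N n≤N _ _
  }
  where
  inject : Fin n → Fin N
  inject j = inject≤ j n≤N
  preserves′ : ∀ {i j} → PathAdj n i j → PathAdj N (inject i) (inject j)
  preserves′ {i} {j} (fwd e) = fwd (trans (toℕ-inject≤ j n≤N) (trans e (cong suc (sym (toℕ-inject≤ i n≤N)))))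
  preserves′ {i} {j} (bwd e) = bwd (trans (toℕ-inject≤ i n≤N) (trans e (cong suc (sym (toℕ-inject≤ j n≤N)))))

module FiniteGraph (G : Graph) (_≟ᵛ_ : DecidableEquality (V G)) (adj? : DecidableAdjacency G)
                   (vertices : List (V G)) (∈-vertices : ∀ v → v ∈ vertices) where

  neighbours : V G → List (V G)
  neighbours u = filter (adj? u) vertices

  ∈-neighbours : ∀ {u v} → Adj G u v → v ∈ neighbours u
  ∈-neighbours {u} {v} = ∈-filter⁺ (adj? u) (∈-vertices v)

  AlongEdges : (V G → V G → Set) → Set
  AlongEdges P = All (λ u → All (P u) (neighbours u)) vertices

  along : ∀ {P} → AlongEdges P → ∀ {u v} → Adj G u v → P u v
  along ps {u} a = All.lookup (All.lookup ps (∈-vertices u)) (∈-neighbours a)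

  IsSelfEmbedding : (V G → V G) → Set
  IsSelfEmbedding φ =
    AlongEdges (λ u v → Adj G (φ u) (φ v)) × All (λ u → All (λ v → φ u ≡ φ v → u ≡ v) vertices) vertices

  isSelfEmbedding? : ∀ φ → Dec (IsSelfEmbedding φ)
  isSelfEmbedding? φ = all? (λ u → all? (λ v → adj? (φ u) (φ v)) (neighbours u)) vertices ×-dec
                       all? (λ u → all? (λ v → φ u ≟ᵛ φ v →-dec u ≟ᵛ v) vertices) vertices

  checkedSelfEmbedding : ∀ φ {_ : True (isSelfEmbedding? φ)} → Embedding G G
  checkedSelfEmbedding φ {checked} with toWitness checked
  ... | preserves , injective = record
    { vertexMap = φ
    ; preserves = along preserves
    ; injective = λ {u} {v} → All.lookup (All.lookup injective (∈-vertices u)) (∈-vertices v)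
    }

  module _ {k : ℕ} (κ : V G → V G → Fin k) where

    SymmetricTable : Set
    SymmetricTable = AlongEdges λ u v → κ u v ≡ κ v u

    ProperTable : Set
    ProperTable = AlongEdges λ u v → All (λ w → u ≡ w ⊎ κ u v ≢ κ v w) (neighbours v)

    StarTable : Set
    StarTable = AlongEdges λ v₀ v₁ → All (λ v₂ → All (λ v₃ → All (λ v₄ →
      v₀ ≡ v₂ ⊎ v₀ ≡ v₃ ⊎ v₁ ≡ v₃ ⊎ v₁ ≡ v₄ ⊎ v₂ ≡ v₄ ⊎
      ¬ (κ v₀ v₁ ≡ κ v₂ v₃ × κ v₁ v₂ ≡ κ v₃ v₄))
      (neighbours v₃)) (neighbours v₂)) (neighbours v₁)

    symmetricTable? : Dec SymmetricTable
    symmetricTable? = all? (λ u → all? (λ v → κ u v ≟ᶠ κ v u) (neighbours u)) vertices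

    properTable? : Dec ProperTable
    properTable? = all? (λ u → all? (λ v → all? (λ w → u ≟ᵛ w ⊎-dec ¬? (κ u v ≟ᶠ κ v w))
      (neighbours v)) (neighbours u)) vertices

    starTable? : Dec StarTable
    starTable? = all? (λ v₀ → all? (λ v₁ → all? (λ v₂ → all? (λ v₃ → all? (λ v₄ →
      v₀ ≟ᵛ v₂ ⊎-dec v₀ ≟ᵛ v₃ ⊎-dec v₁ ≟ᵛ v₃ ⊎-dec v₁ ≟ᵛ v₄ ⊎-dec v₂ ≟ᵛ v₄ ⊎-dec
      ¬? (κ v₀ v₁ ≟ᶠ κ v₂ v₃ ×-dec κ v₁ v₂ ≟ᶠ κ v₃ v₄))
      (neighbours v₃)) (neighbours v₂)) (neighbours v₁)) (neighbours v₀)) vertices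

    tableStarColouring : SymmetricTable → ProperTable → StarTable → StarEdgeColouring G k
    tableStarColouring symmetric proper star = c , isProper , isStar
      where
      c : EdgeColouring G k
      c = record { col = λ u v _ → κ u v ; col-sym = λ u v p _ → along symmetric p }
      isProper : Proper G c
      isProper u v w p q u≢w with All.lookup (along proper p) (∈-neighbours q)
      ... | inj₁ u≡w = λ _ → u≢w u≡w
      ... | inj₂ κ≢  = κ≢
      isStar : Star G c
      isStar v₀ v₁ v₂ v₃ v₄ p₀₁ p₁₂ p₂₃ p₃₄ d₀₂ d₀₃ d₁₃ d₁₄ d₂₄
        with All.lookup (All.lookup (All.lookup (along star p₀₁) (∈-neighbours p₁₂)) (∈-neighbours p₂₃))
               (∈-neighbours p₃₄)
      ... | inj₁ e                                   = λ _ → d₀₂ e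
      ... | inj₂ (inj₁ e)                            = λ _ → d₀₃ e
      ... | inj₂ (inj₂ (inj₁ e))                     = λ _ → d₁₃ e
      ... | inj₂ (inj₂ (inj₂ (inj₁ e)))              = λ _ → d₁₄ e
      ... | inj₂ (inj₂ (inj₂ (inj₂ (inj₁ e))))       = λ _ → d₂₄ e
      ... | inj₂ (inj₂ (inj₂ (inj₂ (inj₂ ¬bichromatic)))) = ¬bichromatic

    checkedStarColouring : {_ : True symmetricTable?} {_ : True properTable?} {_ : True starTable?} →
                           StarEdgeColouring G k
    checkedStarColouring {symmetric} {proper} {star} =
      tableStarColouring (toWitness symmetric) (toWitness proper) (toWitness star)

-- Transferring star edge-colourings

module _ {G H : Graph} (φ : V G → V H) (preserves : ∀ {u v} → Adj G u v → Adj H (φ u) (φ v)) where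

  pullbackColouring : ∀ {k} → EdgeColouring H k → EdgeColouring G k
  pullbackColouring c = record
    { col     = λ u v p → col c (φ u) (φ v) (preserves p)
    ; col-sym = λ u v p q → col-sym c (φ u) (φ v) (preserves p) (preserves q)
    }

  -- Only the ends of the subwalks of length 2 and 3 of a 4-walk need to stay apart.
  pullback : ∀ {k} →
    (∀ {u a w} → Adj G u a → Adj G a w → u ≢ w → φ u ≢ φ w) →
    (∀ {u a b w} → Adj G u a → Adj G a b → Adj G b w → u ≢ w → φ u ≢ φ w) →
    StarEdgeColouring H k → StarEdgeColouring G k
  pullback separates₂ separates₃ (c , proper , star) = pullbackColouring c , proper′ , star′
    where
    proper′ : Proper G (pullbackColouring c)
    proper′ u v w p q u≢w = proper (φ u) (φ v) (φ w) (preserves p) (preserves q) (separates₂ p q u≢w)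
    star′ : Star G (pullbackColouring c)
    star′ v₀ v₁ v₂ v₃ v₄ p₀₁ p₁₂ p₂₃ p₃₄ d₀₂ d₀₃ d₁₃ d₁₄ d₂₄ =
      star (φ v₀) (φ v₁) (φ v₂) (φ v₃) (φ v₄)
        (preserves p₀₁) (preserves p₁₂) (preserves p₂₃) (preserves p₃₄)
        (separates₂ p₀₁ p₁₂ d₀₂) (separates₃ p₀₁ p₁₂ p₂₃ d₀₃) (separates₂ p₁₂ p₂₃ d₁₃)
        (separates₃ p₁₂ p₂₃ p₃₄ d₁₄) (separates₂ p₂₃ p₃₄ d₂₄)

pullback-embedding : ∀ {G H k} → Embedding G H → StarEdgeColouring H k → StarEdgeColouring G k
pullback-embedding e = pullback (vertexMap e) (preserves e)
  (λ _ _ u≢w → u≢w ∘ injective e) (λ _ _ _ u≢w → u≢w ∘ injective e)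

restrict : ∀ {G n N k} → n ≤ N → StarEdgeColouring (G □ PathG N) k → StarEdgeColouring (G □ PathG n) k
restrict n≤N = pullback-embedding (□-embedding₂ (path-embedding n≤N))

widen : ∀ {G k K} → k ≤ K → StarEdgeColouring G k → StarEdgeColouring G K
widen {G} {k} {K} k≤K (c , proper , star) = c′ , proper′ , star′
  where
  embed : Fin k → Fin K
  embed x = inject≤ x k≤K
  embed-injective : ∀ {x y} → embed x ≡ embed y → x ≡ y
  embed-injective = inject≤-injective k≤K k≤K _ _
  c′ : EdgeColouring G K
  c′ = record { col = λ u v p → embed (col c u v p) ; col-sym = λ u v p q → cong embed (col-sym c u v p q) }
  proper′ : Proper G c′
  proper′ u v w p q u≢w = proper u v w p q u≢w ∘ embed-injective
  star′ : Star G c′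
  star′ v₀ v₁ v₂ v₃ v₄ p₀₁ p₁₂ p₂₃ p₃₄ d₀₂ d₀₃ d₁₃ d₁₄ d₂₄ (e₁ , e₂) =
    star v₀ v₁ v₂ v₃ v₄ p₀₁ p₁₂ p₂₃ p₃₄ d₀₂ d₀₃ d₁₃ d₁₄ d₂₄
      (embed-injective e₁ , embed-injective e₂)

more-colours-needed : ∀ {G k} → ¬ StarEdgeColouring G k → ∀ m → StarEdgeColouring G m → k < m
more-colours-needed {k = k} none m c with suc k ≤? m
... | yes k<m = k<m
... | no  k≮m = ⊥-elim (none (widen (≮⇒≥ k≮m) c))

mod-window : ∀ m .{{_ : NonZero m}} a {d} → d < m → (a + d) % m ≡ a % m → d ≡ 0
mod-window m a {zero}  _   _  = refl
mod-window m a {suc d} d<m eq =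
  ⊥-elim (<⇒≱ d<m (∣⇒≤ (∣m+n∣m⇒∣n (divides ((a + suc d) / m) shifted) (n∣m*n (a / m)))))
  where
  open ≡-Reasoning
  shifted : a / m * m + suc d ≡ (a + suc d) / m * m
  shifted = +-cancelˡ-≡ (a % m) _ _ (begin
    a % m + (a / m * m + suc d)           ≡⟨ sym (+-assoc (a % m) _ _) ⟩
    a % m + a / m * m + suc d             ≡⟨ cong (_+ suc d) (sym (m≡m%n+[m/n]*n a m)) ⟩
    a + suc d                             ≡⟨ m≡m%n+[m/n]*n (a + suc d) m ⟩
    (a + suc d) % m + (a + suc d) / m * m ≡⟨ cong (_+ (a + suc d) / m * m) eq ⟩
    a % m + (a + suc d) / m * m           ∎)

mod-injective-near : ∀ m .{{_ : NonZero m}} {k a b} → k < m → a ≤ b → b ≤ k + a → a % m ≡ b % m → a ≡ b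
mod-injective-near m {k} {a} {b} k<m a≤b b≤k+a a≡b = begin
  a           ≡⟨ sym (+-identityʳ a) ⟩
  a + 0       ≡⟨ cong (a +_) (sym d≡0) ⟩
  a + (b ∸ a) ≡⟨ m+[n∸m]≡n a≤b ⟩
  b           ∎
  where
  open ≡-Reasoning
  d≡0 : b ∸ a ≡ 0
  d≡0 = mod-window m a (≤-<-trans (m≤n+o⇒m∸n≤o b a (≤-trans b≤k+a (≤-reflexive (+-comm k a)))) k<m)
    (trans (cong (_% m) (m+[n∸m]≡n a≤b)) (sym a≡b))

suc-mod : ∀ {m} .{{_ : NonZero m}} → 1 < m → ∀ a → suc a % m ≡ suc (a % m) % m
suc-mod {m} 1<m a = trans (%-distribˡ-+ 1 a m) (cong (λ x → (x + a % m) % m) (m<n⇒m%n≡m 1<m))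

module _ {n m : ℕ} .{{_ : NonZero m}} where

  wrap : Fin n → Fin m
  wrap j = toℕ j mod m

  toℕ-wrap : ∀ j → toℕ (wrap j) ≡ toℕ j % m
  toℕ-wrap j = toℕ-fromℕ< _

  wrap-suc : 1 < m → ∀ {i j} → toℕ j ≡ suc (toℕ i) → toℕ (wrap j) ≡ suc (toℕ (wrap i)) % m
  wrap-suc 1<m {i} {j} e = begin
    toℕ (wrap j)           ≡⟨ toℕ-wrap j ⟩
    toℕ j % m              ≡⟨ cong (_% m) e ⟩
    suc (toℕ i) % m        ≡⟨ suc-mod 1<m (toℕ i) ⟩
    suc (toℕ i % m) % m    ≡⟨ cong (λ x → suc x % m) (sym (toℕ-wrap i)) ⟩
    suc (toℕ (wrap i)) % m ∎
    where open ≡-Reasoning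

  wrap-adj : 1 < m → ∀ {i j} → PathAdj n i j → CycAdj m (wrap i) (wrap j)
  wrap-adj 1<m {i} {j} (fwd e) = fwd (wrap-suc 1<m e)
  wrap-adj 1<m {i} {j} (bwd e) = bwd (wrap-suc 1<m e)

module _ {G : Graph} {n : ℕ} where

  record Near (k : ℕ) (x y : V (G □ PathG n)) : Set where
    constructor near
    field
      ahead  : toℕ (proj₂ y) ≤ k + toℕ (proj₂ x)
      behind : toℕ (proj₂ x) ≤ k + toℕ (proj₂ y)

  near-adj : ∀ {x y} → Adj (G □ PathG n) x y → Near 1 x y
  near-adj (left _)        = near (n≤1+n _) (n≤1+n _)
  near-adj (right (fwd e)) = near (≤-reflexive e) (≤-trans (n≤1+n _) (≤-trans (≤-reflexive (sym e)) (n≤1+n _)))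
  near-adj (right (bwd e)) = near (≤-trans (n≤1+n _) (≤-trans (≤-reflexive (sym e)) (n≤1+n _))) (≤-reflexive e)

  near-step : ∀ {k x y z} → Near k x y → Adj (G □ PathG n) y z → Near (suc k) x z
  near-step {k} (near y≤ x≤) a with near-adj a
  ... | near z≤ y≤′ =
    near (≤-trans z≤ (s≤s y≤)) (≤-trans x≤ (≤-trans (+-monoʳ-≤ k y≤′) (≤-reflexive (+-suc k _))))

  wrap-separates : ∀ {m} .{{_ : NonZero m}} {k x y} → k < m → Near k x y → x ≢ y →
                   map₂ (wrap {n} {m}) x ≢ map₂ wrap y
  wrap-separates {m} {k} {i , j} {i′ , j′} k<m (near j′≤ j≤) x≢y e =
    x≢y (cong₂ _,_ (cong proj₁ e) (toℕ-injective same-row))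
    where
    same-mod : toℕ j % m ≡ toℕ j′ % m
    same-mod = trans (sym (toℕ-wrap j)) (trans (cong (toℕ ∘ proj₂) e) (toℕ-wrap j′))
    same-row : toℕ j ≡ toℕ j′
    same-row with ≤-total (toℕ j) (toℕ j′)
    ... | inj₁ j≤j′ = mod-injective-near m k<m j≤j′ j′≤ same-mod
    ... | inj₂ j′≤j = sym (mod-injective-near m k<m j′≤j j≤ (sym same-mod))

  wrap-cover : ∀ {m k} .{{_ : NonZero m}} → 4 ≤ m →
               StarEdgeColouring (G □ Cycle m) k → StarEdgeColouring (G □ PathG n) k
  wrap-cover {m} 4≤m = pullback (map₂ (wrap {n} {m})) (□-map₂ (wrap-adj (≤-trans (s≤s (s≤s z≤n)) 4≤m)))
    (λ p q → wrap-separates (≤-trans (s≤s (s≤s (s≤s z≤n))) 4≤m) (near-step (near-adj p) q))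
    (λ p q r → wrap-separates 4≤m (near-step (near-step (near-adj p) q) r))
    where
    □-map₂ : (∀ {i j} → PathAdj n i j → CycAdj m (wrap i) (wrap j)) →
             ∀ {x y} → Adj (G □ PathG n) x y → Adj (G □ Cycle m) (map₂ wrap x) (map₂ wrap y)
    □-map₂ preserves (left a)  = left a
    □-map₂ preserves (right b) = right (preserves b)

-- Equality patterns of colour sequences

-- The default is returned beyond the end of the list.
nth : {A : Set} → A → List A → ℕ → A
nth d []       _       = d
nth d (x ∷ xs) zero    = x
nth d (x ∷ xs) (suc n) = nth d xs n

applyUpTo-nth : ∀ {A : Set} (d : A) {i} xs → i ≤ length xs → applyUpTo (nth d xs) i ≡ take i xs
applyUpTo-nth d {zero}  xs       _         = refl
applyUpTo-nth d {suc i} (x ∷ xs) (s≤s i≤n) = cong (x ∷_) (applyUpTo-nth d xs i≤n)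

firstIndex : ℕ → List ℕ → ℕ
firstIndex x []       = 0
firstIndex x (y ∷ ys) = if does (x ≟ y) then 0 else suc (firstIndex x ys)

firstOccurrences : List ℕ → List ℕ
firstOccurrences xs = map (λ x → firstIndex x xs) xs

firstIndex-cong : ∀ (f g : ℕ → ℕ) x ys → All (λ y → f x ≡ f y ⇔ g x ≡ g y) ys →
                  firstIndex (f x) (map f ys) ≡ firstIndex (g x) (map g ys)
firstIndex-cong f g x []       []             = refl
firstIndex-cong f g x (y ∷ ys) (fy⇔gy ∷ rest) =
  cong₂ (λ b n → if b then 0 else suc n) (does-⇔ fy⇔gy (f x ≟ f y) (g x ≟ g y)) (firstIndex-cong f g x ys rest)

firstOccurrences-cong : ∀ (f g : ℕ → ℕ) {P : ℕ → Set} →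
                        (∀ {x y} → P x → P y → f x ≡ f y ⇔ g x ≡ g y) → ∀ {xs} → All P xs → firstOccurrences (map f xs) ≡ firstOccurrences (map g xs)
firstOccurrences-cong f g {P} sameKernel {xs} pxs = begin
  map (λ y → firstIndex y (map f xs)) (map f xs) ≡⟨ sym (map-∘ xs) ⟩
  map (λ x → firstIndex (f x) (map f xs)) xs     ≡⟨ map-cong-local (All.map pointwise pxs) ⟩
  map (λ x → firstIndex (g x) (map g xs)) xs     ≡⟨ map-∘ xs ⟩
  map (λ y → firstIndex y (map g xs)) (map g xs) ∎
  where
  open ≡-Reasoning
  pointwise : ∀ {x} → P x → firstIndex (f x) (map f xs) ≡ firstIndex (g x) (map g xs)
  pointwise {x} px = firstIndex-cong f g x xs (All.map (sameKernel px) pxs)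

firstIndex-take : ∀ b xs {x} → x ∈ take b xs → firstIndex x (take b xs) ≡ firstIndex x xs
firstIndex-take (suc b) (y ∷ ys) {x} x∈ with x ≟ y | x∈
... | yes x≡y | _          rewrite dec-true (x ≟ y) x≡y  = refl
... | no  x≢y | here x≡y   = ⊥-elim (x≢y x≡y)
... | no  x≢y | there x∈ys rewrite dec-false (x ≟ y) x≢y = cong suc (firstIndex-take b ys x∈ys)

firstOccurrences-take : ∀ b xs → firstOccurrences (take b xs) ≡ take b (firstOccurrences xs)
firstOccurrences-take b xs = begin
  map (λ x → firstIndex x (take b xs)) (take b xs) ≡⟨ map-cong-local (All.tabulate (firstIndex-take b xs)) ⟩
  map (λ x → firstIndex x xs) (take b xs)          ≡⟨ sym (take-map b xs) ⟩
  take b (firstOccurrences xs)                     ∎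
  where open ≡-Reasoning

_≤ˡ_ : List ℕ → List ℕ → Set
_≤ˡ_ = Lex-≤ _≡_ _<_

_≤ˡ?_ : ∀ xs ys → Dec (xs ≤ˡ ys)
_≤ˡ?_ = ≤-decidable _≟_ _<?_

take-mono-Lex-≤ : ∀ {A : Set} {_≈_ _≺_ : A → A → Set} b {xs ys} →
                  Lex-≤ _≈_ _≺_ xs ys → Lex-≤ _≈_ _≺_ (take b xs) (take b ys)
take-mono-Lex-≤ zero    _             = base tt
take-mono-Lex-≤ (suc b) (base tt)     = base tt
take-mono-Lex-≤ (suc b) halt          = halt
take-mono-Lex-≤ (suc b) (this x≺y)    = this x≺y
take-mono-Lex-≤ (suc b) (next x≈y le) = next x≈y (take-mono-Lex-≤ b le)

LexLeast : List (List ℕ) → (ℕ → ℕ) → ℕ → Set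
LexLeast πs f i = All (λ π → firstOccurrences (map f (upTo i)) ≤ˡ firstOccurrences (map f (take i π))) πs

lexLeast? : ∀ πs f i → Dec (LexLeast πs f i)
lexLeast? πs f i =
  all? (λ π → firstOccurrences (map f (upTo i)) ≤ˡ? firstOccurrences (map f (take i π))) πs

lexLeast-transport : ∀ {πs f g i} →
  (∀ {xs} → All (_< i) xs → firstOccurrences (map f xs) ≡ firstOccurrences (map g xs)) →
  All (λ π → All (_< i) (take i π)) πs → LexLeast πs f i → LexLeast πs g i
lexLeast-transport {πs} {f} {g} {i} samePattern earlier least = All.zipWith transport (earlier , least)
  where
  transport : ∀ {π} →
    All (_< i) (take i π) × firstOccurrences (map f (upTo i)) ≤ˡ firstOccurrences (map f (take i π)) →
    firstOccurrences (map g (upTo i)) ≤ˡ firstOccurrences (map g (take i π))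
  transport (earlier-π , le) = subst₂ _≤ˡ_ (samePattern (all-upTo i)) (samePattern earlier-π) le

-- Backtracking search for colour sequences

data Constraint : Set where
  differs        : ℕ → Constraint
  notBichromatic : ℕ → ℕ → ℕ → Constraint

Satisfies : (ℕ → ℕ) → ℕ → Constraint → Set
Satisfies F i (differs p)            = F i ≢ F p
Satisfies F i (notBichromatic q x y) = ¬ (F x ≡ F y × F i ≡ F q)

Earlier : ℕ → Constraint → Set
Earlier i (differs p)            = p < i
Earlier i (notBichromatic q x y) = q < i × x < i × y < i

earlier? : ∀ i c → Dec (Earlier i c)
earlier? i (differs p)            = p <? i
earlier? i (notBichromatic q x y) = q <? i ×-dec x <? i ×-dec y <? i

record Stage : Set where
  constructor stage
  field
    constraints   : List Constraint
    breakSymmetry : Bool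
open Stage public

Admissible : List (List ℕ) → (ℕ → ℕ) → ℕ → List Stage → Set
Admissible πs F i []       = ⊤
Admissible πs F i (s ∷ ss) =
  All (λ c → Earlier i c × Satisfies F i c) (constraints s) ×
  (T (breakSymmetry s) → All (λ π → All (_< i) (take i π)) πs × LexLeast πs F i) ×
  Admissible πs F (suc i) ss

injection⇒≤ : ∀ {n m} (h : ℕ → ℕ) → (∀ {x} → x < n → h x < m) →
              (∀ {x y} → x < n → y < n → h x ≡ h y → x ≡ y) → n ≤ m
injection⇒≤ h h< h-injective = injective⇒≤ {f = λ x → fromℕ< (h< (toℕ<n x))} λ {x} {y} e →
  toℕ-injective (h-injective (toℕ<n x) (toℕ<n y)
    (trans (sym (toℕ-fromℕ< _)) (trans (cong toℕ e) (toℕ-fromℕ< _))))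

T-implication : ∀ a {b} → (T a → T b) → T (not a ∨ b)
T-implication false _   = tt
T-implication true  a⇒b = a⇒b tt

update : (ℕ → ℕ) → ℕ → ℕ → ℕ → ℕ
update h x v y = if does (y ≟ x) then v else h y

update-≢ : ∀ h {x} v {y} → y ≢ x → update h x v y ≡ h y
update-≢ h {x} v {y} y≢x rewrite dec-false (y ≟ x) y≢x = refl

update-≡ : ∀ h x v → update h x v x ≡ v
update-≡ h x v rewrite dec-true (x ≟ x) refl = refl

-- search i stages σ used: σ lists the colours of items i-1, …, 0 (latest first), named 0, 1, …
-- in order of first appearance; used of them have appeared and at most K are available.
module Backtracking (K : ℕ) (πs : List (List ℕ)) where

  colourAt : ℕ → List ℕ → ℕ → ℕ
  colourAt i σ p = nth 0 σ (i ∸ suc p)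

  colourAt-old : ∀ {i} σ c {p} → p < i → colourAt (suc i) (c ∷ σ) p ≡ colourAt i σ p
  colourAt-old σ c p<i = cong (nth 0 (c ∷ σ)) (+-∸-assoc 1 p<i)

  colourAt-new : ∀ i σ c → colourAt (suc i) (c ∷ σ) i ≡ c
  colourAt-new i σ c = cong (nth 0 (c ∷ σ)) (n∸n≡0 i)

  forbidden : ℕ → List ℕ → List Constraint → List ℕ
  forbidden i σ []                          = []
  forbidden i σ (differs p ∷ cs)            = colourAt i σ p ∷ forbidden i σ cs
  forbidden i σ (notBichromatic q x y ∷ cs) =
    if does (colourAt i σ x ≟ colourAt i σ y) then colourAt i σ q ∷ forbidden i σ cs else forbidden i σ cs

  candidates : ℕ → ℕ
  candidates used = if used <ᵇ K then suc used else used

  mutual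
    search : ℕ → List Stage → List ℕ → ℕ → Bool
    search i []       σ used = true
    search i (s ∷ ss) σ used =
      (not (breakSymmetry s) ∨ does (lexLeast? πs (colourAt i σ) i)) ∧
      tryColours i ss σ used (forbidden i σ (constraints s)) 0 (candidates used)

    tryColours : ℕ → List Stage → List ℕ → ℕ → List ℕ → ℕ → ℕ → Bool
    tryColours i ss σ used fb c zero    = false
    tryColours i ss σ used fb c (suc r) =
      (not (does (c ∈? fb)) ∧ search (suc i) ss (c ∷ σ) (used ⊔ suc c)) ∨
      tryColours i ss σ used fb (suc c) r

  candidates-≥ : ∀ used → used ≤ candidates used
  candidates-≥ used with used <ᵇ K
  ... | true  = n≤1+n used
  ... | false = ≤-refl

  candidates-> : ∀ {used} → used < K → used < candidates used
  candidates-> {used} used<K rewrite dec-true (used <? K) used<K = ≤-refl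

  tryColours-accepts : ∀ {i ss σ used fb} c r {c*} → c ≤ c* → c* < c + r → c* ∉ fb →
                       T (search (suc i) ss (c* ∷ σ) (used ⊔ suc c*)) → T (tryColours i ss σ used fb c r)
  tryColours-accepts c zero {c*} c≤c* c*<c+0 _ _ = ⊥-elim (<⇒≱ (subst (c* <_) (+-identityʳ c) c*<c+0) c≤c*)
  tryColours-accepts {fb = fb} c (suc r) {c*} c≤c* c*<c+r c*∉fb accepted with c ≟ c*
  ... | yes refl rewrite dec-false (c ∈? fb) c*∉fb = Equivalence.from T-∨ (inj₁ accepted)
  ... | no c≢c*  = Equivalence.from T-∨ (inj₂
        (tryColours-accepts (suc c) r (≤∧≢⇒< c≤c* c≢c*) (subst (c* <_) (+-suc c r) c*<c+r) c*∉fb accepted))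

  module _ {F : ℕ → ℕ} (F<K : ∀ p → F p < K) where

    -- h translates the names used by the search back into the colours of F.
    record Tracks (i : ℕ) (σ : List ℕ) (used : ℕ) (h : ℕ → ℕ) : Set where
      field
        named     : ∀ {p} → p < i → colourAt i σ p < used
        decode    : ∀ {p} → p < i → h (colourAt i σ p) ≡ F p
        injective : ∀ {x y} → x < used → y < used → h x ≡ h y → x ≡ y
        bounded   : ∀ {x} → x < used → h x < K
    open Tracks

    tracks-[] : Tracks 0 [] 0 id
    tracks-[] = record { named = λ () ; decode = λ () ; injective = λ () ; bounded = λ () }

    extendWith : ∀ {i σ c} (P : ℕ → ℕ → Set) → (∀ {p} → p < i → P p (colourAt i σ p)) → P i c →
                 ∀ {p} → p < suc i → P p (colourAt (suc i) (c ∷ σ) p)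
    extendWith {i} {σ} {c} P old new {p} p<1+i with m<1+n⇒m<n∨m≡n p<1+i
    ... | inj₁ p<i  rewrite colourAt-old σ c p<i = old p<i
    ... | inj₂ refl rewrite colourAt-new i σ c   = new

    tracks-old : ∀ {i σ used h x} → Tracks i σ used h → x < used → h x ≡ F i →
                 Tracks (suc i) (x ∷ σ) used h
    tracks-old {used = used} {h} t x<used hx≡Fi = record
      { named     = extendWith (λ _ a → a < used) (named t) x<used
      ; decode    = extendWith (λ p a → h a ≡ F p) (decode t) hx≡Fi
      ; injective = injective t
      ; bounded   = bounded t
      }

    tracks-new : ∀ {i σ used h} → Tracks i σ used h → (∀ {x} → x < used → h x ≢ F i) →
                 Tracks (suc i) (used ∷ σ) (suc used) (update h used (F i))
    tracks-new {i} {σ} {used} {h} t fresh = record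
      { named     = extendWith (λ _ a → a < suc used) (m<n⇒m<1+n ∘ named t) ≤-refl
      ; decode    = extendWith (λ p a → h′ a ≡ F p) (λ p<i → trans (old (named t p<i)) (decode t p<i)) new
      ; injective = injective′
      ; bounded   = bounded′
      }
      where
      h′ : ℕ → ℕ
      h′ = update h used (F i)
      old : ∀ {x} → x < used → h′ x ≡ h x
      old x<used = update-≢ h (F i) (<⇒≢ x<used)
      new : h′ used ≡ F i
      new = update-≡ h used (F i)
      injective′ : ∀ {x y} → x < suc used → y < suc used → h′ x ≡ h′ y → x ≡ y
      injective′ x<1+u y<1+u e with m<1+n⇒m<n∨m≡n x<1+u | m<1+n⇒m<n∨m≡n y<1+u
      ... | inj₁ x<u  | inj₁ y<u  = injective t x<u y<u (trans (sym (old x<u)) (trans e (old y<u)))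
      ... | inj₁ x<u  | inj₂ refl = ⊥-elim (fresh x<u (trans (sym (old x<u)) (trans e new)))
      ... | inj₂ refl | inj₁ y<u  = ⊥-elim (fresh y<u (trans (sym (old y<u)) (trans (sym e) new)))
      ... | inj₂ refl | inj₂ refl = refl
      bounded′ : ∀ {x} → x < suc used → h′ x < K
      bounded′ x<1+u with m<1+n⇒m<n∨m≡n x<1+u
      ... | inj₁ x<u  rewrite old x<u = bounded t x<u
      ... | inj₂ refl rewrite new     = F<K i

    same-kernel : ∀ {i σ used h p q} → Tracks i σ used h → p < i → q < i →
                  colourAt i σ p ≡ colourAt i σ q ⇔ F p ≡ F q
    same-kernel {h = h} t p<i q<i = mk⇔
      (λ e → trans (sym (decode t p<i)) (trans (cong h e) (decode t q<i)))
      (λ e → injective t (named t p<i) (named t q<i) (trans (decode t p<i) (trans e (sym (decode t q<i)))))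

    forbidden-excludes : ∀ {i σ used h c} → Tracks i σ used h →
                         (∀ {p} → p < i → colourAt i σ p ≡ c → F p ≡ F i) → ∀ cs → All (λ k → Earlier i k × Satisfies F i k) cs → c ∉ forbidden i σ cs
    forbidden-excludes t sameClass (differs p ∷ cs) ((p<i , Fi≢Fp) ∷ rest) (here c≡) =
      Fi≢Fp (sym (sameClass p<i (sym c≡)))
    forbidden-excludes t sameClass (differs p ∷ cs) (_ ∷ rest) (there c∈) = forbidden-excludes t sameClass cs rest c∈
    forbidden-excludes {i} {σ} t sameClass (notBichromatic q x y ∷ cs) (((q<i , x<i , y<i) , ¬bichromatic) ∷ rest)
      with colourAt i σ x ≟ colourAt i σ y
    ... | no x≢y  rewrite dec-false (colourAt i σ x ≟ colourAt i σ y) x≢y = forbidden-excludes t sameClass cs rest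
    ... | yes x≡y rewrite dec-true (colourAt i σ x ≟ colourAt i σ y) x≡y = λ where
      (here c≡)  → ¬bichromatic (Equivalence.to (same-kernel t x<i y<i) x≡y , sym (sameClass q<i (sym c≡)))
      (there c∈) → forbidden-excludes t sameClass cs rest c∈

    search-accepts : ∀ {i σ used h} ss → Tracks i σ used h → Admissible πs F i ss → T (search i ss σ used)
    search-accepts []       _ _ = tt
    search-accepts {i} {σ} {used} {h} (s ∷ ss) t (satisfied , symmetric , admissible) =
      Equivalence.from T-∧ (symmetryBroken , coloured)
      where
      symmetryBroken : T (not (breakSymmetry s) ∨ does (lexLeast? πs (colourAt i σ) i))
      symmetryBroken = T-implication (breakSymmetry s) λ flagged →
        let earlier , least = symmetric flagged in
        subst T (sym (dec-true (lexLeast? πs (colourAt i σ) i)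
          (lexLeast-transport (sym ∘ firstOccurrences-cong (colourAt i σ) F (same-kernel t)) earlier least))) tt
      coloured : T (tryColours i ss σ used (forbidden i σ (constraints s)) 0 (candidates used))
      coloured with anyUpTo? (λ x → h x ≟ F i) used
      ... | yes (x , x<used , hx≡Fi) =
        tryColours-accepts 0 (candidates used) z≤n (≤-trans x<used (candidates-≥ used))
          (forbidden-excludes t (λ p<i e → trans (sym (decode t p<i)) (trans (cong h e) hx≡Fi)) (constraints s) satisfied)
          (subst (λ u → T (search (suc i) ss (x ∷ σ) u)) (sym (m≥n⇒m⊔n≡m x<used))
            (search-accepts ss (tracks-old t x<used hx≡Fi) admissible))
      ... | no unnamed =
        tryColours-accepts 0 (candidates used) z≤n (candidates-> used<K)
          (forbidden-excludes t (λ p<i e → ⊥-elim (<⇒≢ (named t p<i) e)) (constraints s) satisfied)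
          (subst (λ u → T (search (suc i) ss (used ∷ σ) u)) (sym (m≤n⇒m⊔n≡n (n≤1+n used)))
            (search-accepts ss (tracks-new t fresh) admissible))
        where
        fresh : ∀ {x} → x < used → h x ≢ F i
        fresh x<used hx≡Fi = unnamed (_ , x<used , hx≡Fi)
        used<K : used < K
        used<K = injection⇒≤ (update h used (F i)) (bounded (tracks-new t fresh)) (injective (tracks-new t fresh))

    search-complete : ∀ ss → Admissible πs F 0 ss → T (search 0 ss [] 0)
    search-complete ss = search-accepts ss tracks-[]

-- Symmetry breaking

Breakable : List (List ℕ) → ℕ → List Stage → Set
Breakable πs i []       = ⊤
Breakable πs i (s ∷ ss) =
  (T (breakSymmetry s) → All (λ π → i ≤ length π × All (_< i) (take i π)) πs) × Breakable πs (suc i) ss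

breakable? : ∀ πs i ss → Dec (Breakable πs i ss)
breakable? πs i []       = yes tt
breakable? πs i (s ∷ ss) =
  (T? (breakSymmetry s) →-dec all? (λ π → i ≤? length π ×-dec all? (_<? i) (take i π)) πs) ×-dec
  breakable? πs (suc i) ss

Closed : List (List ℕ) → Set
Closed πs = All (λ a → All (λ b → map (nth 0 a) b ∈ πs) πs) πs

closed? : ∀ πs → Dec (Closed πs)
closed? πs = all? (λ a → all? (λ b → map (nth 0 a) b ∈ˡ? πs) πs) πs

-- π* minimises the equality pattern of F ∘ π over πs; by closure, F ∘ π* is then lex-least
-- among its own images, and so is each of its prefixes.
lexLeast-representative : ∀ (F : ℕ → ℕ) {π₀} πs → π₀ ∈ πs → Closed πs →
  Σ (List ℕ) λ π* → π* ∈ πs × (∀ i → i ≤ length π* → LexLeast πs (F ∘ nth 0 π*) i)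
lexLeast-representative F {π₀} πs π₀∈ closed = π* , π*∈ , least
  where
  key : List ℕ → List ℕ
  key π = firstOccurrences (map F π)
  π* : List ℕ
  π* = argmin key π₀ πs
  π*∈ : π* ∈ πs
  π*∈ with argmin-sel key π₀ πs
  ... | inj₁ π*≡π₀ = subst (_∈ πs) (sym π*≡π₀) π₀∈
  ... | inj₂ π*∈πs = π*∈πs
  minimal : ∀ {π} → π ∈ πs → key π* ≤ˡ key π
  minimal = All.lookup (f[argmin]≤f[xs] {f = key} π₀ πs)
  least : ∀ i → i ≤ length π* → LexLeast πs (F ∘ nth 0 π*) i
  least i i≤ = All.tabulate λ {π} π∈ → subst₂ _≤ˡ_ prefix-of-π* (prefix-of-image π)
    (take-mono-Lex-≤ i (minimal (All.lookup (All.lookup closed π*∈) π∈)))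
    where
    open ≡-Reasoning
    take≡ : take i π* ≡ map (nth 0 π*) (upTo i)
    take≡ = trans (sym (applyUpTo-nth 0 π* i≤)) (sym (map-applyUpTo id (nth 0 π*) i))
    prefix-of-π* : take i (key π*) ≡ firstOccurrences (map (F ∘ nth 0 π*) (upTo i))
    prefix-of-π* = begin
      take i (key π*)                                    ≡⟨ sym (firstOccurrences-take i (map F π*)) ⟩
      firstOccurrences (take i (map F π*))               ≡⟨ cong firstOccurrences (take-map i π*) ⟩
      firstOccurrences (map F (take i π*))               ≡⟨ cong (firstOccurrences ∘ map F) take≡ ⟩
      firstOccurrences (map F (map (nth 0 π*) (upTo i))) ≡⟨ cong firstOccurrences (sym (map-∘ (upTo i))) ⟩
      firstOccurrences (map (F ∘ nth 0 π*) (upTo i))     ∎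
    prefix-of-image : ∀ π → take i (key (map (nth 0 π*) π)) ≡ firstOccurrences (map (F ∘ nth 0 π*) (take i π))
    prefix-of-image π = begin
      take i (key (map (nth 0 π*) π))                      ≡⟨ sym (firstOccurrences-take i _) ⟩
      firstOccurrences (take i (map F (map (nth 0 π*) π))) ≡⟨ cong (firstOccurrences ∘ take i) (sym (map-∘ π)) ⟩
      firstOccurrences (take i (map (F ∘ nth 0 π*) π))     ≡⟨ cong firstOccurrences (take-map i π) ⟩
      firstOccurrences (map (F ∘ nth 0 π*) (take i π))     ∎

-- Certified non-existence of star edge-colourings

module Arcs (G : Graph) (_≟ᵛ_ : DecidableEquality (V G)) (reverse-adj : ∀ {u v} → Adj G u v → Adj G v u) where

  Arc : Set
  Arc = Σ (V G × V G) λ e → Adj G (proj₁ e) (proj₂ e)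

  source target : Arc → V G
  source = proj₁ ∘ proj₁
  target = proj₂ ∘ proj₁

  reverse : Arc → Arc
  reverse α = (target α , source α) , reverse-adj (proj₂ α)

  orientations : Arc → List Arc
  orientations α = α ∷ reverse α ∷ []

  Consecutive : Arc → Arc → Set
  Consecutive α β = target α ≡ source β × source α ≢ target β

  FourWalk : Arc → Arc → Arc → Arc → Set
  FourWalk α β γ δ =
    (target α ≡ source β × target β ≡ source γ × target γ ≡ source δ) ×
    (source α ≢ target β × source α ≢ target γ × source β ≢ target γ ×
     source β ≢ target δ × source γ ≢ target δ)

  Meet : Arc → Arc → Set
  Meet α β = Any (λ α′ → Any (Consecutive α′) (orientations β)) (orientations α)

  OnFourWalk : Arc → Arc → Arc → Arc → Set
  OnFourWalk α β γ δ = Any (λ α′ → Any (λ β′ → Any (λ γ′ → Any (FourWalk α′ β′ γ′)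
    (orientations δ)) (orientations γ)) (orientations β)) (orientations α)

  meet? : ∀ α β → Dec (Meet α β)
  meet? α β = any? (λ α′ → any? (λ β′ →
    target α′ ≟ᵛ source β′ ×-dec ¬? (source α′ ≟ᵛ target β′)) (orientations β)) (orientations α)

  onFourWalk? : ∀ α β γ δ → Dec (OnFourWalk α β γ δ)
  onFourWalk? α β γ δ = any? (λ α′ → any? (λ β′ → any? (λ γ′ → any? (λ δ′ →
    (target α′ ≟ᵛ source β′ ×-dec target β′ ≟ᵛ source γ′ ×-dec target γ′ ≟ᵛ source δ′) ×-dec
    (¬? (source α′ ≟ᵛ target β′) ×-dec ¬? (source α′ ≟ᵛ target γ′) ×-dec
     ¬? (source β′ ≟ᵛ target γ′) ×-dec ¬? (source β′ ≟ᵛ target δ′) ×-dec ¬? (source γ′ ≟ᵛ target δ′)))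
    (orientations δ)) (orientations γ)) (orientations β)) (orientations α)

  SameEdge : Arc → Arc → Set
  SameEdge α β = Any (λ α′ → source α′ ≡ source β × target α′ ≡ target β) (orientations α)

  sameEdge? : ∀ α β → Dec (SameEdge α β)
  sameEdge? α β = any? (λ α′ → source α′ ≟ᵛ source β ×-dec target α′ ≟ᵛ target β) (orientations α)

  image : Embedding G G → Arc → Arc
  image σ α = (vertexMap σ (source α) , vertexMap σ (target α)) , preserves σ (proj₂ α)

  Induces : (ℕ → Arc) → Embedding G G → List ℕ → Set
  Induces arc σ π = All (λ p → SameEdge (arc (nth 0 π p)) (image σ (arc p))) (upTo (length π))

  induces? : ∀ arc σ π → Dec (Induces arc σ π)
  induces? arc σ π = all? (λ p → sameEdge? (arc (nth 0 π p)) (image σ (arc p))) (upTo (length π))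

  Valid : (ℕ → Arc) → ℕ → Constraint → Set
  Valid arc i (differs p)            = Meet (arc i) (arc p)
  Valid arc i (notBichromatic q x y) = OnFourWalk (arc i) (arc x) (arc q) (arc y) ⊎ OnFourWalk (arc x) (arc i) (arc y) (arc q)

  valid? : ∀ e i c → Dec (Valid e i c)
  valid? arc i (differs p)            = meet? (arc i) (arc p)
  valid? arc i (notBichromatic q x y) =
    onFourWalk? (arc i) (arc x) (arc q) (arc y) ⊎-dec onFourWalk? (arc x) (arc i) (arc y) (arc q)

  module _ {k : ℕ} (c : EdgeColouring G k) where

    colour : Arc → Fin k
    colour α = col c (source α) (target α) (proj₂ α)

    reorient : ∀ {P : Arc → Set} {α} → Any P (orientations α) →
               Σ Arc λ α′ → colour α′ ≡ colour α × P α′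
    reorient {α = α}               (here p)         = α , refl , p
    reorient {α = ((u , v) , a)} (there (here p)) = _ , sym (col-sym c u v a (reverse-adj a)) , p

    colour-sameEdge : ∀ {α β} → SameEdge α β → colour α ≡ colour β
    colour-sameEdge {β = (u , v) , b} same with reorient same
    ... | ((.u , .v) , a) , a≡α , (refl , refl) =
      trans (sym a≡α) (trans (col-sym c u v a (reverse-adj a)) (sym (col-sym c u v b (reverse-adj a))))

    consecutive-proper : Proper G c → ∀ α β → Consecutive α β → colour α ≢ colour β
    consecutive-proper proper ((u , v) , p) ((.v , w) , q) (refl , u≢w) = proper u v w p q u≢w

    fourWalk-star : Star G c → ∀ α β γ δ → FourWalk α β γ δ →
                    ¬ (colour α ≡ colour γ × colour β ≡ colour δ)
    fourWalk-star star ((v₀ , v₁) , p₀₁) ((.v₁ , v₂) , p₁₂) ((.v₂ , v₃) , p₂₃) ((.v₃ , v₄) , p₃₄)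
      ((refl , refl , refl) , d₀₂ , d₀₃ , d₁₃ , d₁₄ , d₂₄) =
      star v₀ v₁ v₂ v₃ v₄ p₀₁ p₁₂ p₂₃ p₃₄ d₀₂ d₀₃ d₁₃ d₁₄ d₂₄

    meet-proper : Proper G c → ∀ {α β} → Meet α β → colour α ≢ colour β
    meet-proper proper meet α≡β with reorient meet
    ... | α′ , α′≡α , meet′ with reorient meet′
    ... | β′ , β′≡β , consecutive =
      consecutive-proper proper α′ β′ consecutive (trans α′≡α (trans α≡β (sym β′≡β)))

    onFourWalk-star : Star G c → ∀ {α β γ δ} → OnFourWalk α β γ δ →
                      ¬ (colour α ≡ colour γ × colour β ≡ colour δ)
    onFourWalk-star star w (α≡γ , β≡δ) with reorient w
    ... | α′ , α′≡α , w₁ with reorient w₁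
    ... | β′ , β′≡β , w₂ with reorient w₂
    ... | γ′ , γ′≡γ , w₃ with reorient w₃
    ... | δ′ , δ′≡δ , walk = fourWalk-star star α′ β′ γ′ δ′ walk
      (trans α′≡α (trans α≡γ (sym γ′≡γ)) , trans β′≡β (trans β≡δ (sym δ′≡δ)))

    valid-satisfied : Proper G c → Star G c → ∀ arc {i} k → Valid arc i k → Satisfies (toℕ ∘ colour ∘ arc) i k
    valid-satisfied proper star arc (differs p) meet = meet-proper proper meet ∘ toℕ-injective
    valid-satisfied proper star arc (notBichromatic q x y) (inj₁ w) (x≡y , i≡q) =
      onFourWalk-star star w (toℕ-injective i≡q , toℕ-injective x≡y)
    valid-satisfied proper star arc (notBichromatic q x y) (inj₂ w) (x≡y , i≡q) =
      onFourWalk-star star w (toℕ-injective x≡y , toℕ-injective i≡q)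

  StagesValid : (ℕ → Arc) → ℕ → List Stage → Set
  StagesValid arc i []       = ⊤
  StagesValid arc i (s ∷ ss) = All (λ k → Earlier i k × Valid arc i k) (constraints s) × StagesValid arc (suc i) ss

  stagesValid? : ∀ arc i ss → Dec (StagesValid arc i ss)
  stagesValid? arc i []       = yes tt
  stagesValid? arc i (s ∷ ss) =
    all? (λ k → earlier? i k ×-dec valid? arc i k) (constraints s) ×-dec stagesValid? arc (suc i) ss

  -- A star K-edge-colouring c is pulled back along the symmetry σ* whose permutation is lex-least
  -- for c; the colour sequence of the pulled-back colouring then passes every check of the search.
  no-star-colouring : ∀ (arc : ℕ → Arc) K stages (σs : List (Embedding G G)) (onIndices : Embedding G G → List ℕ) →
    ∀ {σ₀} → σ₀ ∈ σs → All (λ σ → Induces arc σ (onIndices σ)) σs →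
    Closed (map onIndices σs) → Breakable (map onIndices σs) 0 stages → StagesValid arc 0 stages →
    ¬ T (Backtracking.search K (map onIndices σs) 0 stages [] 0) → ¬ StarEdgeColouring G K
  no-star-colouring arc K stages σs onIndices σ₀∈ induced closed breakable valid rejected colouring =
    rejected (search-complete (λ _ → toℕ<n _) stages (admissible 0 stages valid breakable))
    where
    open Backtracking K (map onIndices σs)
    πs : List (List ℕ)
    πs = map onIndices σs
    F₀ : ℕ → ℕ
    F₀ = toℕ ∘ colour (proj₁ colouring) ∘ arc
    representative : Σ (List ℕ) λ π* → π* ∈ πs × (∀ i → i ≤ length π* → LexLeast πs (F₀ ∘ nth 0 π*) i)
    representative = lexLeast-representative F₀ πs (∈-map⁺ onIndices σ₀∈) closed
    π* : List ℕ
    π* = proj₁ representative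
    symmetry : Σ (Embedding G G) λ σ → σ ∈ σs × π* ≡ onIndices σ
    symmetry = ∈-map⁻ onIndices (proj₁ (proj₂ representative))
    σ* : Embedding G G
    σ* = proj₁ symmetry
    c* : StarEdgeColouring G K
    c* = pullback-embedding σ* colouring
    F* : ℕ → ℕ
    F* = toℕ ∘ colour (proj₁ c*) ∘ arc
    agree : ∀ {p} → p < length π* → F₀ (nth 0 π* p) ≡ F* p
    agree {p} = subst (λ π → p < length π → F₀ (nth 0 π p) ≡ F* p) (sym (proj₂ (proj₂ symmetry))) λ p<len →
      cong toℕ (colour-sameEdge (proj₁ colouring)
        (All.lookup (All.lookup induced (proj₁ (proj₂ symmetry))) (∈-upTo⁺ p<len)))
    admissible : ∀ i ss → StagesValid arc i ss → Breakable πs i ss → Admissible πs F* i ss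
    admissible i []       _                    _                            = tt
    admissible i (s ∷ ss) (valid-s , valid-ss) (breakable-s , breakable-ss) =
      All.map (λ (earlier , v) →
        earlier , valid-satisfied (proj₁ c*) (proj₁ (proj₂ c*)) (proj₂ (proj₂ c*)) arc _ v) valid-s ,
      (λ flagged →
        let i≤length = proj₁ (All.lookup (breakable-s flagged) (proj₁ (proj₂ representative)))
            earlier  = All.map proj₂ (breakable-s flagged)
        in earlier , lexLeast-transport
             (cong firstOccurrences ∘ map-cong-local ∘ All.map (λ p<i → agree (≤-trans p<i i≤length)))
             earlier (proj₂ (proj₂ representative) i i≤length)) ,
      admissible (suc i) ss valid-ss breakable-ss

-- The graphs C₅ □ H

module C₅□ (H : Graph) (_≟ᴴ_ : DecidableEquality (V H)) (adjH? : DecidableAdjacency H)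
           (verticesH : List (V H)) (∈-verticesH : ∀ v → v ∈ verticesH) =
  FiniteGraph (Cycle 5 □ H) (≡-dec-× _≟ᶠ_ _≟ᴴ_) (□-adj? _≟ᶠ_ _≟ᴴ_ (cycle-adj? 5) adjH?)
    (cartesianProduct (allFin 5) verticesH) (λ (i , j) → ∈-cartesianProduct⁺ (∈-allFin i) (∈-verticesH j))

-- The end of the cycle edge {i, i′} from which it leaves in the positive direction.
forwardEnd : ∀ {m} .{{_ : NonZero m}} → Fin m → Fin m → ℕ
forwardEnd {m} i i′ = if toℕ i′ ≡ᵇ suc (toℕ i) % m then toℕ i else toℕ i′

-- rows j i is the colour of (i , j)(i + 1 , j), and rungs j i that of (i , j)(i , j + 1).
gridColouring : ∀ {h} .{{_ : NonZero h}} k .{{_ : NonZero k}} →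
                List (List ℕ) → List (List ℕ) → Fin 5 × Fin h → Fin 5 × Fin h → Fin k
gridColouring k rows rungs (i , j) (i′ , j′) =
  (if toℕ j ≡ᵇ toℕ j′ then nth 0 (nth [] rows (toℕ j)) (forwardEnd i i′)
                      else nth 0 (nth [] rungs (forwardEnd j j′)) (toℕ i)) mod k

starColouring₆ : StarEdgeColouring (Cycle 5 □ PathG 6) 6
starColouring₆ = C₅□P₆.checkedStarColouring (gridColouring 6
  ( (0 ∷ 1 ∷ 2 ∷ 3 ∷ 4 ∷ []) ∷ (0 ∷ 5 ∷ 3 ∷ 2 ∷ 1 ∷ []) ∷ (2 ∷ 0 ∷ 2 ∷ 1 ∷ 4 ∷ [])
  ∷ (5 ∷ 2 ∷ 4 ∷ 1 ∷ 2 ∷ []) ∷ (0 ∷ 5 ∷ 1 ∷ 2 ∷ 3 ∷ []) ∷ (1 ∷ 5 ∷ 4 ∷ 3 ∷ 2 ∷ []) ∷ [])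
  ( (2 ∷ 3 ∷ 4 ∷ 0 ∷ 5 ∷ []) ∷ (5 ∷ 4 ∷ 1 ∷ 4 ∷ 3 ∷ []) ∷ (3 ∷ 1 ∷ 3 ∷ 5 ∷ 0 ∷ [])
  ∷ (1 ∷ 4 ∷ 0 ∷ 3 ∷ 4 ∷ []) ∷ (4 ∷ 3 ∷ 2 ∷ 0 ∷ 5 ∷ []) ∷ []))
  where module C₅□P₆ = C₅□ (PathG 6) _≟ᶠ_ (path-adj? 6) (allFin 6) ∈-allFin

starColouring₇ : StarEdgeColouring (Cycle 5 □ Cycle 4) 7
starColouring₇ = C₅□C₄.checkedStarColouring (gridColouring 7
  ( (0 ∷ 1 ∷ 0 ∷ 2 ∷ 3 ∷ []) ∷ (5 ∷ 6 ∷ 3 ∷ 6 ∷ 1 ∷ []) ∷ (0 ∷ 1 ∷ 5 ∷ 2 ∷ 3 ∷ [])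
  ∷ (5 ∷ 6 ∷ 4 ∷ 6 ∷ 1 ∷ []) ∷ [])
  ( (2 ∷ 2 ∷ 2 ∷ 4 ∷ 4 ∷ []) ∷ (4 ∷ 4 ∷ 4 ∷ 0 ∷ 5 ∷ []) ∷ (6 ∷ 2 ∷ 0 ∷ 3 ∷ 0 ∷ [])
  ∷ (4 ∷ 3 ∷ 3 ∷ 5 ∷ 5 ∷ []) ∷ []))
  where module C₅□C₄ = C₅□ (Cycle 4) _≟ᶠ_ (cycle-adj? 4) (allFin 4) ∈-allFin

module C₅ = FiniteGraph (Cycle 5) _≟ᶠ_ (cycle-adj? 5) (allFin 5) ∈-allFin

rotation reflection : Embedding (Cycle 5) (Cycle 5)
rotation   = C₅.checkedSelfEmbedding (λ i → suc (toℕ i) mod 5)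
reflection = C₅.checkedSelfEmbedding (λ i → (5 ∸ toℕ i) mod 5)

dihedral₅ : List (Embedding (Cycle 5) (Cycle 5))
dihedral₅ = applyUpTo (rotation ^ᵉ_) 5 ++ applyUpTo (λ t → (rotation ^ᵉ t) ∘ᵉ reflection) 5

-- Edge 10 j + r of C₅ □ P_{m+1} is (r , j)(r + 1 , j) for r < 5 and (r - 5 , j)(r - 5 , j + 1) otherwise.
module Cylinder (m : ℕ) .{{_ : NonZero m}} where
  open Arcs (Cycle 5 □ PathG (suc m)) (≡-dec-× _≟ᶠ_ _≟ᶠ_) (□-reverse cycle-reverse path-reverse) public

  rowArc : Fin 5 → Fin (suc m) → Arc
  rowArc i j = ((i , j) , (suc (toℕ i) mod 5 , j)) , left (fwd (toℕ-fromℕ< _))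

  rungArc : Fin 5 → Fin m → Arc
  rungArc i j = ((i , inject₁ j) , (i , Fin.suc j)) , right (fwd (cong suc (sym (toℕ-inject₁ j))))

  arcAt : ℕ → Arc
  arcAt p = if r <ᵇ 5 then rowArc (r mod 5) (j mod suc m) else rungArc ((r ∸ 5) mod 5) (j mod m)
    where
    r j : ℕ
    r = p % 10
    j = p / 10

  edgeIndex : Arc → ℕ
  edgeIndex (((i , j) , (i′ , j′)) , _) =
    if toℕ j ≡ᵇ toℕ j′ then 10 * toℕ j + forwardEnd i i′ else 10 * (toℕ j ⊓ toℕ j′) + 5 + toℕ i

  onIndices : Embedding (Cycle 5 □ PathG (suc m)) (Cycle 5 □ PathG (suc m)) → List ℕ
  onIndices σ = map (edgeIndex ∘ image σ ∘ arcAt) (upTo (10 * m + 5))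

  certified : ∀ K stages σs {σ₀} → σ₀ ∈ σs →
    {_ : True (all? (λ σ → induces? arcAt σ (onIndices σ)) σs)} → {_ : True (closed? (map onIndices σs))} →
    {_ : True (breakable? (map onIndices σs) 0 stages)} → {_ : True (stagesValid? arcAt 0 stages)} →
    ¬ T (Backtracking.search K (map onIndices σs) 0 stages [] 0) → ¬ StarEdgeColouring (Cycle 5 □ PathG (suc m)) K
  certified K stages σs σ₀∈ {induced} {closed} {breakable} {valid} =
    no-star-colouring arcAt K stages σs onIndices σ₀∈
      (toWitness induced) (toWitness closed) (toWitness breakable) (toWitness valid)

-- The constraint lists below were generated by an external program.  Only their soundness
-- matters, and it is checked: every constraint comes from a path or a 4-walk of the graph.

stages₃ : List Stage
stages₃ =
  stage ([]) false
  ∷ stage (differs 0 ∷ []) false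
  ∷ stage (differs 1 ∷ []) false
  ∷ stage (differs 2 ∷ notBichromatic 1 2 0 ∷ []) false
  ∷ stage (differs 3 ∷ differs 0 ∷ notBichromatic 2 0 3 ∷ notBichromatic 1 3 0 ∷ notBichromatic 2 3 1 ∷ notBichromatic 1 0 2 ∷ []) false
  ∷ stage (differs 4 ∷ differs 0 ∷ notBichromatic 1 0 2 ∷ notBichromatic 3 4 2 ∷ []) false
  ∷ stage (differs 0 ∷ differs 1 ∷ notBichromatic 2 1 3 ∷ notBichromatic 4 0 3 ∷ []) false
  ∷ stage (differs 2 ∷ differs 1 ∷ notBichromatic 0 1 4 ∷ notBichromatic 3 2 4 ∷ notBichromatic 0 1 5 ∷ []) false
  ∷ stage (differs 3 ∷ differs 2 ∷ notBichromatic 1 2 0 ∷ notBichromatic 4 3 0 ∷ notBichromatic 4 3 5 ∷ notBichromatic 1 2 6 ∷ []) false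
  ∷ stage (differs 3 ∷ differs 4 ∷ notBichromatic 0 4 1 ∷ notBichromatic 2 3 1 ∷ notBichromatic 0 4 6 ∷ notBichromatic 2 3 7 ∷ []) false
  ∷ stage (differs 6 ∷ differs 5 ∷ notBichromatic 0 6 5 ∷ notBichromatic 0 5 6 ∷ notBichromatic 0 5 1 ∷ notBichromatic 1 5 6 ∷ notBichromatic 1 6 2 ∷ notBichromatic 4 5 3 ∷ notBichromatic 0 6 4 ∷ notBichromatic 4 6 5 ∷ notBichromatic 0 6 5 ∷ notBichromatic 0 5 6 ∷ notBichromatic 1 6 7 ∷ notBichromatic 4 5 9 ∷ []) false
  ∷ stage (differs 7 ∷ differs 10 ∷ differs 6 ∷ notBichromatic 1 7 0 ∷ notBichromatic 5 10 0 ∷ notBichromatic 0 7 6 ∷ notBichromatic 1 7 6 ∷ notBichromatic 1 6 7 ∷ notBichromatic 1 10 7 ∷ notBichromatic 1 6 2 ∷ notBichromatic 2 6 7 ∷ notBichromatic 2 10 7 ∷ notBichromatic 2 7 3 ∷ notBichromatic 0 6 4 ∷ notBichromatic 5 10 4 ∷ notBichromatic 0 6 5 ∷ notBichromatic 5 7 10 ∷ notBichromatic 1 7 6 ∷ notBichromatic 1 6 7 ∷ notBichromatic 2 7 8 ∷ []) false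
  ∷ stage (differs 7 ∷ differs 11 ∷ differs 8 ∷ notBichromatic 1 7 0 ∷ notBichromatic 6 11 0 ∷ notBichromatic 2 8 1 ∷ notBichromatic 6 11 1 ∷ notBichromatic 1 8 7 ∷ notBichromatic 2 8 7 ∷ notBichromatic 2 7 8 ∷ notBichromatic 2 11 8 ∷ notBichromatic 2 7 3 ∷ notBichromatic 3 7 8 ∷ notBichromatic 3 11 8 ∷ notBichromatic 3 8 4 ∷ notBichromatic 10 11 5 ∷ notBichromatic 1 7 6 ∷ notBichromatic 6 8 11 ∷ notBichromatic 2 8 7 ∷ notBichromatic 2 7 8 ∷ notBichromatic 10 8 11 ∷ notBichromatic 3 8 9 ∷ []) false
  ∷ stage (differs 8 ∷ differs 9 ∷ differs 12 ∷ notBichromatic 4 9 0 ∷ notBichromatic 2 8 1 ∷ notBichromatic 7 12 1 ∷ notBichromatic 3 9 2 ∷ notBichromatic 7 12 2 ∷ notBichromatic 2 9 8 ∷ notBichromatic 3 9 8 ∷ notBichromatic 3 8 9 ∷ notBichromatic 3 12 9 ∷ notBichromatic 3 8 4 ∷ notBichromatic 4 8 9 ∷ notBichromatic 4 12 9 ∷ notBichromatic 4 9 5 ∷ notBichromatic 11 12 6 ∷ notBichromatic 2 8 7 ∷ notBichromatic 7 9 12 ∷ notBichromatic 3 9 8 ∷ notBichromatic 3 8 9 ∷ notBichromatic 11 9 12 ∷ notBichromatic 11 12 10 ∷ []) false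
  ∷ stage (differs 13 ∷ differs 10 ∷ differs 9 ∷ differs 5 ∷ notBichromatic 4 9 0 ∷ notBichromatic 0 9 5 ∷ notBichromatic 0 13 5 ∷ notBichromatic 6 10 0 ∷ notBichromatic 0 5 1 ∷ notBichromatic 6 10 1 ∷ notBichromatic 3 9 2 ∷ notBichromatic 8 13 2 ∷ notBichromatic 4 5 3 ∷ notBichromatic 8 13 3 ∷ notBichromatic 3 5 9 ∷ notBichromatic 3 10 9 ∷ notBichromatic 4 9 5 ∷ notBichromatic 4 13 5 ∷ notBichromatic 4 5 9 ∷ notBichromatic 4 10 9 ∷ notBichromatic 4 9 5 ∷ notBichromatic 8 5 13 ∷ notBichromatic 12 5 13 ∷ notBichromatic 0 5 6 ∷ notBichromatic 6 9 10 ∷ notBichromatic 6 13 10 ∷ notBichromatic 11 10 7 ∷ notBichromatic 12 13 7 ∷ notBichromatic 3 9 8 ∷ notBichromatic 8 10 13 ∷ notBichromatic 4 5 9 ∷ notBichromatic 11 9 10 ∷ notBichromatic 12 10 13 ∷ notBichromatic 11 13 10 ∷ notBichromatic 12 13 11 ∷ notBichromatic 11 10 12 ∷ []) false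
  ∷ stage (differs 14 ∷ differs 5 ∷ differs 10 ∷ notBichromatic 6 10 0 ∷ notBichromatic 0 5 1 ∷ notBichromatic 6 10 1 ∷ notBichromatic 4 5 3 ∷ notBichromatic 9 14 3 ∷ notBichromatic 9 14 4 ∷ notBichromatic 0 5 6 ∷ notBichromatic 11 10 7 ∷ notBichromatic 13 14 8 ∷ notBichromatic 4 5 9 ∷ notBichromatic 11 10 12 ∷ notBichromatic 13 14 12 ∷ []) false
  ∷ stage (differs 11 ∷ differs 10 ∷ differs 6 ∷ notBichromatic 5 10 0 ∷ notBichromatic 7 11 1 ∷ notBichromatic 1 6 2 ∷ notBichromatic 7 11 2 ∷ notBichromatic 0 6 4 ∷ notBichromatic 5 10 4 ∷ notBichromatic 0 6 5 ∷ notBichromatic 1 6 7 ∷ notBichromatic 12 11 8 ∷ notBichromatic 14 10 9 ∷ notBichromatic 12 11 13 ∷ notBichromatic 14 10 13 ∷ []) false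
  ∷ stage (differs 12 ∷ differs 11 ∷ differs 7 ∷ notBichromatic 1 7 0 ∷ notBichromatic 6 11 0 ∷ notBichromatic 6 11 1 ∷ notBichromatic 8 12 2 ∷ notBichromatic 2 7 3 ∷ notBichromatic 8 12 3 ∷ notBichromatic 10 11 5 ∷ notBichromatic 1 7 6 ∷ notBichromatic 2 7 8 ∷ notBichromatic 13 12 9 ∷ notBichromatic 10 11 14 ∷ notBichromatic 13 12 14 ∷ notBichromatic 10 11 15 ∷ []) false
  ∷ stage (differs 12 ∷ differs 8 ∷ differs 13 ∷ notBichromatic 2 8 1 ∷ notBichromatic 7 12 1 ∷ notBichromatic 7 12 2 ∷ notBichromatic 9 13 3 ∷ notBichromatic 3 8 4 ∷ notBichromatic 9 13 4 ∷ notBichromatic 14 13 5 ∷ notBichromatic 11 12 6 ∷ notBichromatic 2 8 7 ∷ notBichromatic 3 8 9 ∷ notBichromatic 11 12 10 ∷ notBichromatic 14 13 10 ∷ notBichromatic 14 13 15 ∷ notBichromatic 11 12 16 ∷ []) false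
  ∷ stage (differs 13 ∷ differs 9 ∷ differs 14 ∷ notBichromatic 4 9 0 ∷ notBichromatic 5 14 0 ∷ notBichromatic 3 9 2 ∷ notBichromatic 8 13 2 ∷ notBichromatic 8 13 3 ∷ notBichromatic 5 14 4 ∷ notBichromatic 4 9 5 ∷ notBichromatic 10 14 6 ∷ notBichromatic 12 13 7 ∷ notBichromatic 3 9 8 ∷ notBichromatic 10 14 11 ∷ notBichromatic 12 13 11 ∷ notBichromatic 10 14 16 ∷ notBichromatic 12 13 17 ∷ []) false
  ∷ stage (differs 16 ∷ differs 15 ∷ notBichromatic 5 15 0 ∷ notBichromatic 6 16 0 ∷ notBichromatic 6 16 1 ∷ notBichromatic 5 15 4 ∷ notBichromatic 10 16 5 ∷ notBichromatic 5 16 15 ∷ notBichromatic 10 15 6 ∷ notBichromatic 6 15 16 ∷ notBichromatic 11 16 7 ∷ notBichromatic 14 15 9 ∷ notBichromatic 10 16 15 ∷ notBichromatic 10 15 16 ∷ notBichromatic 10 15 11 ∷ notBichromatic 11 15 16 ∷ notBichromatic 11 16 12 ∷ notBichromatic 14 15 13 ∷ notBichromatic 10 16 14 ∷ notBichromatic 14 16 15 ∷ notBichromatic 10 16 15 ∷ notBichromatic 10 15 16 ∷ notBichromatic 11 16 17 ∷ notBichromatic 14 15 19 ∷ []) false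
  ∷ stage (differs 20 ∷ differs 17 ∷ differs 16 ∷ notBichromatic 6 16 0 ∷ notBichromatic 6 16 1 ∷ notBichromatic 7 17 1 ∷ notBichromatic 7 17 2 ∷ notBichromatic 10 16 5 ∷ notBichromatic 15 20 5 ∷ notBichromatic 11 17 6 ∷ notBichromatic 6 17 16 ∷ notBichromatic 11 16 7 ∷ notBichromatic 7 16 17 ∷ notBichromatic 7 20 17 ∷ notBichromatic 12 17 8 ∷ notBichromatic 11 17 10 ∷ notBichromatic 15 20 10 ∷ notBichromatic 10 17 16 ∷ notBichromatic 11 17 16 ∷ notBichromatic 11 16 17 ∷ notBichromatic 11 20 17 ∷ notBichromatic 11 16 12 ∷ notBichromatic 12 16 17 ∷ notBichromatic 12 20 17 ∷ notBichromatic 12 17 13 ∷ notBichromatic 10 16 14 ∷ notBichromatic 15 20 14 ∷ notBichromatic 10 16 15 ∷ notBichromatic 15 17 20 ∷ notBichromatic 11 17 16 ∷ notBichromatic 11 16 17 ∷ notBichromatic 12 17 18 ∷ []) false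
  ∷ stage (differs 17 ∷ differs 18 ∷ differs 21 ∷ notBichromatic 7 17 1 ∷ notBichromatic 7 17 2 ∷ notBichromatic 8 18 2 ∷ notBichromatic 8 18 3 ∷ notBichromatic 11 17 6 ∷ notBichromatic 16 21 6 ∷ notBichromatic 12 18 7 ∷ notBichromatic 7 18 17 ∷ notBichromatic 12 17 8 ∷ notBichromatic 8 17 18 ∷ notBichromatic 8 21 18 ∷ notBichromatic 13 18 9 ∷ notBichromatic 11 17 10 ∷ notBichromatic 16 21 10 ∷ notBichromatic 12 18 11 ∷ notBichromatic 16 21 11 ∷ notBichromatic 11 18 17 ∷ notBichromatic 12 18 17 ∷ notBichromatic 12 17 18 ∷ notBichromatic 12 21 18 ∷ notBichromatic 12 17 13 ∷ notBichromatic 13 17 18 ∷ notBichromatic 13 21 18 ∷ notBichromatic 13 18 14 ∷ notBichromatic 20 21 15 ∷ notBichromatic 11 17 16 ∷ notBichromatic 16 18 21 ∷ notBichromatic 12 18 17 ∷ notBichromatic 12 17 18 ∷ notBichromatic 20 18 21 ∷ notBichromatic 13 18 19 ∷ []) false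
  ∷ stage (differs 22 ∷ differs 18 ∷ differs 19 ∷ notBichromatic 8 18 2 ∷ notBichromatic 8 18 3 ∷ notBichromatic 9 19 3 ∷ notBichromatic 9 19 4 ∷ notBichromatic 14 19 5 ∷ notBichromatic 12 18 7 ∷ notBichromatic 17 22 7 ∷ notBichromatic 13 19 8 ∷ notBichromatic 8 19 18 ∷ notBichromatic 13 18 9 ∷ notBichromatic 9 18 19 ∷ notBichromatic 9 22 19 ∷ notBichromatic 14 19 10 ∷ notBichromatic 12 18 11 ∷ notBichromatic 17 22 11 ∷ notBichromatic 13 19 12 ∷ notBichromatic 17 22 12 ∷ notBichromatic 12 19 18 ∷ notBichromatic 13 19 18 ∷ notBichromatic 13 18 19 ∷ notBichromatic 13 22 19 ∷ notBichromatic 13 18 14 ∷ notBichromatic 14 18 19 ∷ notBichromatic 14 22 19 ∷ notBichromatic 14 19 15 ∷ notBichromatic 21 22 16 ∷ notBichromatic 12 18 17 ∷ notBichromatic 17 19 22 ∷ notBichromatic 13 19 18 ∷ notBichromatic 13 18 19 ∷ notBichromatic 21 19 22 ∷ notBichromatic 21 22 20 ∷ []) false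
  ∷ stage (differs 23 ∷ differs 20 ∷ differs 19 ∷ differs 15 ∷ notBichromatic 5 15 0 ∷ notBichromatic 9 19 3 ∷ notBichromatic 5 15 4 ∷ notBichromatic 9 19 4 ∷ notBichromatic 14 19 5 ∷ notBichromatic 5 19 15 ∷ notBichromatic 5 23 15 ∷ notBichromatic 10 15 6 ∷ notBichromatic 16 20 6 ∷ notBichromatic 13 19 8 ∷ notBichromatic 18 23 8 ∷ notBichromatic 14 15 9 ∷ notBichromatic 9 15 19 ∷ notBichromatic 9 20 19 ∷ notBichromatic 14 19 10 ∷ notBichromatic 10 19 15 ∷ notBichromatic 10 23 15 ∷ notBichromatic 16 20 10 ∷ notBichromatic 10 15 11 ∷ notBichromatic 16 20 11 ∷ notBichromatic 13 19 12 ∷ notBichromatic 18 23 12 ∷ notBichromatic 14 15 13 ∷ notBichromatic 18 23 13 ∷ notBichromatic 13 15 19 ∷ notBichromatic 13 20 19 ∷ notBichromatic 14 19 15 ∷ notBichromatic 14 23 15 ∷ notBichromatic 14 15 19 ∷ notBichromatic 14 20 19 ∷ notBichromatic 14 19 15 ∷ notBichromatic 18 15 23 ∷ notBichromatic 22 15 23 ∷ notBichromatic 10 15 16 ∷ notBichromatic 16 19 20 ∷ notBichromatic 16 23 20 ∷ notBichromatic 21 20 17 ∷ notBichromatic 22 23 17 ∷ notBichromatic 13 19 18 ∷ notBichromatic 18 20 23 ∷ notBichromatic 14 15 19 ∷ notBichromatic 21 19 20 ∷ notBichromatic 22 20 23 ∷ notBichromatic 21 23 20 ∷ notBichromatic 22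 23 21 ∷ notBichromatic 21 20 22 ∷ []) false
  ∷ []

noStar₃ : ¬ StarEdgeColouring (Cycle 5 □ PathG 3) 5
noStar₃ = Cylinder.certified 2 5 stages₃ (idᵉ ∷ []) (here refl) (λ ())

stages₇ : List Stage
stages₇ =
  stage ([]) false
  ∷ stage (differs 0 ∷ []) false
  ∷ stage (differs 1 ∷ []) false
  ∷ stage (differs 2 ∷ notBichromatic 1 2 0 ∷ []) false
  ∷ stage (differs 0 ∷ differs 3 ∷ notBichromatic 2 0 3 ∷ notBichromatic 1 3 0 ∷ notBichromatic 2 3 1 ∷ notBichromatic 1 0 2 ∷ []) false
  ∷ stage (differs 4 ∷ differs 0 ∷ notBichromatic 1 0 2 ∷ notBichromatic 3 4 2 ∷ []) true
  ∷ stage (differs 0 ∷ differs 1 ∷ notBichromatic 2 1 3 ∷ notBichromatic 4 0 3 ∷ []) false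
  ∷ stage (differs 1 ∷ differs 2 ∷ notBichromatic 0 1 4 ∷ notBichromatic 3 2 4 ∷ notBichromatic 0 1 5 ∷ []) false
  ∷ stage (differs 2 ∷ differs 3 ∷ notBichromatic 1 2 0 ∷ notBichromatic 4 3 0 ∷ notBichromatic 4 3 5 ∷ notBichromatic 1 2 6 ∷ []) false
  ∷ stage (differs 4 ∷ differs 3 ∷ notBichromatic 0 4 1 ∷ notBichromatic 2 3 1 ∷ notBichromatic 0 4 6 ∷ notBichromatic 2 3 7 ∷ []) false
  ∷ stage (differs 6 ∷ differs 5 ∷ notBichromatic 0 6 5 ∷ notBichromatic 0 5 6 ∷ notBichromatic 0 5 1 ∷ notBichromatic 1 5 6 ∷ notBichromatic 1 6 2 ∷ notBichromatic 4 5 3 ∷ notBichromatic 0 6 4 ∷ notBichromatic 4 6 5 ∷ notBichromatic 0 6 5 ∷ notBichromatic 0 5 6 ∷ notBichromatic 1 6 7 ∷ notBichromatic 4 5 9 ∷ []) false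
  ∷ stage (differs 6 ∷ differs 10 ∷ differs 7 ∷ notBichromatic 1 7 0 ∷ notBichromatic 5 10 0 ∷ notBichromatic 0 7 6 ∷ notBichromatic 1 7 6 ∷ notBichromatic 1 6 7 ∷ notBichromatic 1 10 7 ∷ notBichromatic 1 6 2 ∷ notBichromatic 2 6 7 ∷ notBichromatic 2 10 7 ∷ notBichromatic 2 7 3 ∷ notBichromatic 0 6 4 ∷ notBichromatic 5 10 4 ∷ notBichromatic 0 6 5 ∷ notBichromatic 5 7 10 ∷ notBichromatic 1 7 6 ∷ notBichromatic 1 6 7 ∷ notBichromatic 2 7 8 ∷ []) false
  ∷ stage (differs 7 ∷ differs 8 ∷ differs 11 ∷ notBichromatic 1 7 0 ∷ notBichromatic 6 11 0 ∷ notBichromatic 2 8 1 ∷ notBichromatic 6 11 1 ∷ notBichromatic 1 8 7 ∷ notBichromatic 2 8 7 ∷ notBichromatic 2 7 8 ∷ notBichromatic 2 11 8 ∷ notBichromatic 2 7 3 ∷ notBichromatic 3 7 8 ∷ notBichromatic 3 11 8 ∷ notBichromatic 3 8 4 ∷ notBichromatic 10 11 5 ∷ notBichromatic 1 7 6 ∷ notBichromatic 6 8 11 ∷ notBichromatic 2 8 7 ∷ notBichromatic 2 7 8 ∷ notBichromatic 10 8 11 ∷ notBichromatic 3 8 9 ∷ []) false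
  ∷ stage (differs 9 ∷ differs 8 ∷ differs 12 ∷ notBichromatic 4 9 0 ∷ notBichromatic 2 8 1 ∷ notBichromatic 7 12 1 ∷ notBichromatic 3 9 2 ∷ notBichromatic 7 12 2 ∷ notBichromatic 2 9 8 ∷ notBichromatic 3 9 8 ∷ notBichromatic 3 8 9 ∷ notBichromatic 3 12 9 ∷ notBichromatic 3 8 4 ∷ notBichromatic 4 8 9 ∷ notBichromatic 4 12 9 ∷ notBichromatic 4 9 5 ∷ notBichromatic 11 12 6 ∷ notBichromatic 2 8 7 ∷ notBichromatic 7 9 12 ∷ notBichromatic 3 9 8 ∷ notBichromatic 3 8 9 ∷ notBichromatic 11 9 12 ∷ notBichromatic 11 12 10 ∷ []) false
  ∷ stage (differs 13 ∷ differs 5 ∷ differs 10 ∷ differs 9 ∷ notBichromatic 4 9 0 ∷ notBichromatic 0 9 5 ∷ notBichromatic 0 13 5 ∷ notBichromatic 6 10 0 ∷ notBichromatic 0 5 1 ∷ notBichromatic 6 10 1 ∷ notBichromatic 3 9 2 ∷ notBichromatic 8 13 2 ∷ notBichromatic 4 5 3 ∷ notBichromatic 8 13 3 ∷ notBichromatic 3 5 9 ∷ notBichromatic 3 10 9 ∷ notBichromatic 4 9 5 ∷ notBichromatic 4 13 5 ∷ notBichromatic 4 5 9 ∷ notBichromatic 4 10 9 ∷ notBichromatic 4 9 5 ∷ notBichromatic 8 5 13 ∷ notBichromatic 12 5 13 ∷ notBichromatic 0 5 6 ∷ notBichromatic 6 9 10 ∷ notBichromatic 6 13 10 ∷ notBichromatic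 11 10 7 ∷ notBichromatic 12 13 7 ∷ notBichromatic 3 9 8 ∷ notBichromatic 8 10 13 ∷ notBichromatic 4 5 9 ∷ notBichromatic 11 9 10 ∷ notBichromatic 12 10 13 ∷ notBichromatic 11 13 10 ∷ notBichromatic 12 13 11 ∷ notBichromatic 11 10 12 ∷ []) false
  ∷ stage (differs 10 ∷ differs 14 ∷ differs 5 ∷ notBichromatic 6 10 0 ∷ notBichromatic 0 5 1 ∷ notBichromatic 6 10 1 ∷ notBichromatic 4 5 3 ∷ notBichromatic 9 14 3 ∷ notBichromatic 9 14 4 ∷ notBichromatic 0 5 6 ∷ notBichromatic 11 10 7 ∷ notBichromatic 13 14 8 ∷ notBichromatic 4 5 9 ∷ notBichromatic 11 10 12 ∷ notBichromatic 13 14 12 ∷ []) true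
  ∷ stage (differs 11 ∷ differs 6 ∷ differs 10 ∷ notBichromatic 5 10 0 ∷ notBichromatic 7 11 1 ∷ notBichromatic 1 6 2 ∷ notBichromatic 7 11 2 ∷ notBichromatic 0 6 4 ∷ notBichromatic 5 10 4 ∷ notBichromatic 0 6 5 ∷ notBichromatic 1 6 7 ∷ notBichromatic 12 11 8 ∷ notBichromatic 14 10 9 ∷ notBichromatic 12 11 13 ∷ notBichromatic 14 10 13 ∷ []) false
  ∷ stage (differs 7 ∷ differs 11 ∷ differs 12 ∷ notBichromatic 1 7 0 ∷ notBichromatic 6 11 0 ∷ notBichromatic 6 11 1 ∷ notBichromatic 8 12 2 ∷ notBichromatic 2 7 3 ∷ notBichromatic 8 12 3 ∷ notBichromatic 10 11 5 ∷ notBichromatic 1 7 6 ∷ notBichromatic 2 7 8 ∷ notBichromatic 13 12 9 ∷ notBichromatic 10 11 14 ∷ notBichromatic 13 12 14 ∷ notBichromatic 10 11 15 ∷ []) false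
  ∷ stage (differs 13 ∷ differs 8 ∷ differs 12 ∷ notBichromatic 2 8 1 ∷ notBichromatic 7 12 1 ∷ notBichromatic 7 12 2 ∷ notBichromatic 9 13 3 ∷ notBichromatic 3 8 4 ∷ notBichromatic 9 13 4 ∷ notBichromatic 14 13 5 ∷ notBichromatic 11 12 6 ∷ notBichromatic 2 8 7 ∷ notBichromatic 3 8 9 ∷ notBichromatic 11 12 10 ∷ notBichromatic 14 13 10 ∷ notBichromatic 14 13 15 ∷ notBichromatic 11 12 16 ∷ []) false
  ∷ stage (differs 9 ∷ differs 14 ∷ differs 13 ∷ notBichromatic 4 9 0 ∷ notBichromatic 5 14 0 ∷ notBichromatic 3 9 2 ∷ notBichromatic 8 13 2 ∷ notBichromatic 8 13 3 ∷ notBichromatic 5 14 4 ∷ notBichromatic 4 9 5 ∷ notBichromatic 10 14 6 ∷ notBichromatic 12 13 7 ∷ notBichromatic 3 9 8 ∷ notBichromatic 10 14 11 ∷ notBichromatic 12 13 11 ∷ notBichromatic 10 14 16 ∷ notBichromatic 12 13 17 ∷ []) false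
  ∷ stage (differs 15 ∷ differs 16 ∷ notBichromatic 5 15 0 ∷ notBichromatic 6 16 0 ∷ notBichromatic 6 16 1 ∷ notBichromatic 5 15 4 ∷ notBichromatic 10 16 5 ∷ notBichromatic 5 16 15 ∷ notBichromatic 10 15 6 ∷ notBichromatic 6 15 16 ∷ notBichromatic 11 16 7 ∷ notBichromatic 14 15 9 ∷ notBichromatic 10 16 15 ∷ notBichromatic 10 15 16 ∷ notBichromatic 10 15 11 ∷ notBichromatic 11 15 16 ∷ notBichromatic 11 16 12 ∷ notBichromatic 14 15 13 ∷ notBichromatic 10 16 14 ∷ notBichromatic 14 16 15 ∷ notBichromatic 10 16 15 ∷ notBichromatic 10 15 16 ∷ notBichromatic 11 16 17 ∷ notBichromatic 14 15 19 ∷ []) false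
  ∷ stage (differs 16 ∷ differs 17 ∷ differs 20 ∷ notBichromatic 6 16 0 ∷ notBichromatic 6 16 1 ∷ notBichromatic 7 17 1 ∷ notBichromatic 7 17 2 ∷ notBichromatic 10 16 5 ∷ notBichromatic 15 20 5 ∷ notBichromatic 11 17 6 ∷ notBichromatic 6 17 16 ∷ notBichromatic 11 16 7 ∷ notBichromatic 7 16 17 ∷ notBichromatic 7 20 17 ∷ notBichromatic 12 17 8 ∷ notBichromatic 11 17 10 ∷ notBichromatic 15 20 10 ∷ notBichromatic 10 17 16 ∷ notBichromatic 11 17 16 ∷ notBichromatic 11 16 17 ∷ notBichromatic 11 20 17 ∷ notBichromatic 11 16 12 ∷ notBichromatic 12 16 17 ∷ notBichromatic 12 20 17 ∷ notBichromatic 12 17 13 ∷ notBichromatic 10 16 14 ∷ notBichromatic 15 20 14 ∷ notBichromatic 10 16 15 ∷ notBichromatic 15 17 20 ∷ notBichromatic 11 17 16 ∷ notBichromatic 11 16 17 ∷ notBichromatic 12 17 18 ∷ []) false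
  ∷ stage (differs 18 ∷ differs 17 ∷ differs 21 ∷ notBichromatic 7 17 1 ∷ notBichromatic 7 17 2 ∷ notBichromatic 8 18 2 ∷ notBichromatic 8 18 3 ∷ notBichromatic 11 17 6 ∷ notBichromatic 16 21 6 ∷ notBichromatic 12 18 7 ∷ notBichromatic 7 18 17 ∷ notBichromatic 12 17 8 ∷ notBichromatic 8 17 18 ∷ notBichromatic 8 21 18 ∷ notBichromatic 13 18 9 ∷ notBichromatic 11 17 10 ∷ notBichromatic 16 21 10 ∷ notBichromatic 12 18 11 ∷ notBichromatic 16 21 11 ∷ notBichromatic 11 18 17 ∷ notBichromatic 12 18 17 ∷ notBichromatic 12 17 18 ∷ notBichromatic 12 21 18 ∷ notBichromatic 12 17 13 ∷ notBichromatic 13 17 18 ∷ notBichromatic 13 21 18 ∷ notBichromatic 13 18 14 ∷ notBichromatic 20 21 15 ∷ notBichromatic 11 17 16 ∷ notBichromatic 16 18 21 ∷ notBichromatic 12 18 17 ∷ notBichromatic 12 17 18 ∷ notBichromatic 20 18 21 ∷ notBichromatic 13 18 19 ∷ []) false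
  ∷ stage (differs 19 ∷ differs 22 ∷ differs 18 ∷ notBichromatic 8 18 2 ∷ notBichromatic 8 18 3 ∷ notBichromatic 9 19 3 ∷ notBichromatic 9 19 4 ∷ notBichromatic 14 19 5 ∷ notBichromatic 12 18 7 ∷ notBichromatic 17 22 7 ∷ notBichromatic 13 19 8 ∷ notBichromatic 8 19 18 ∷ notBichromatic 13 18 9 ∷ notBichromatic 9 18 19 ∷ notBichromatic 9 22 19 ∷ notBichromatic 14 19 10 ∷ notBichromatic 12 18 11 ∷ notBichromatic 17 22 11 ∷ notBichromatic 13 19 12 ∷ notBichromatic 17 22 12 ∷ notBichromatic 12 19 18 ∷ notBichromatic 13 19 18 ∷ notBichromatic 13 18 19 ∷ notBichromatic 13 22 19 ∷ notBichromatic 13 18 14 ∷ notBichromatic 14 18 19 ∷ notBichromatic 14 22 19 ∷ notBichromatic 14 19 15 ∷ notBichromatic 21 22 16 ∷ notBichromatic 12 18 17 ∷ notBichromatic 17 19 22 ∷ notBichromatic 13 19 18 ∷ notBichromatic 13 18 19 ∷ notBichromatic 21 19 22 ∷ notBichromatic 21 22 20 ∷ []) false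
  ∷ stage (differs 15 ∷ differs 19 ∷ differs 23 ∷ differs 20 ∷ notBichromatic 5 15 0 ∷ notBichromatic 9 19 3 ∷ notBichromatic 5 15 4 ∷ notBichromatic 9 19 4 ∷ notBichromatic 14 19 5 ∷ notBichromatic 5 19 15 ∷ notBichromatic 5 23 15 ∷ notBichromatic 10 15 6 ∷ notBichromatic 16 20 6 ∷ notBichromatic 13 19 8 ∷ notBichromatic 18 23 8 ∷ notBichromatic 14 15 9 ∷ notBichromatic 9 15 19 ∷ notBichromatic 9 20 19 ∷ notBichromatic 14 19 10 ∷ notBichromatic 10 19 15 ∷ notBichromatic 10 23 15 ∷ notBichromatic 16 20 10 ∷ notBichromatic 10 15 11 ∷ notBichromatic 16 20 11 ∷ notBichromatic 13 19 12 ∷ notBichromatic 18 23 12 ∷ notBichromatic 14 15 13 ∷ notBichromatic 18 23 13 ∷ notBichromatic 13 15 19 ∷ notBichromatic 13 20 19 ∷ notBichromatic 14 19 15 ∷ notBichromatic 14 23 15 ∷ notBichromatic 14 15 19 ∷ notBichromatic 14 20 19 ∷ notBichromatic 14 19 15 ∷ notBichromatic 18 15 23 ∷ notBichromatic 22 15 23 ∷ notBichromatic 10 15 16 ∷ notBichromatic 16 19 20 ∷ notBichromatic 16 23 20 ∷ notBichromatic 21 20 17 ∷ notBichromatic 22 23 17 ∷ notBichromatic 13 19 18 ∷ notBichromatic 18 20 23 ∷ notBichromatic 14 15 19 ∷ notBichromatic 21 19 20 ∷ notBichromatic 22 20 23 ∷ notBichromatic 21 23 20 ∷ notBichromatic 22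 23 21 ∷ notBichromatic 21 20 22 ∷ []) false
  ∷ stage (differs 20 ∷ differs 15 ∷ differs 24 ∷ notBichromatic 5 15 0 ∷ notBichromatic 5 15 4 ∷ notBichromatic 10 15 6 ∷ notBichromatic 16 20 6 ∷ notBichromatic 14 15 9 ∷ notBichromatic 19 24 9 ∷ notBichromatic 16 20 10 ∷ notBichromatic 10 15 11 ∷ notBichromatic 16 20 11 ∷ notBichromatic 14 15 13 ∷ notBichromatic 19 24 13 ∷ notBichromatic 19 24 14 ∷ notBichromatic 10 15 16 ∷ notBichromatic 21 20 17 ∷ notBichromatic 23 24 18 ∷ notBichromatic 14 15 19 ∷ notBichromatic 21 20 22 ∷ notBichromatic 23 24 22 ∷ []) false
  ∷ stage (differs 21 ∷ differs 16 ∷ differs 20 ∷ notBichromatic 6 16 0 ∷ notBichromatic 6 16 1 ∷ notBichromatic 10 16 5 ∷ notBichromatic 15 20 5 ∷ notBichromatic 11 16 7 ∷ notBichromatic 17 21 7 ∷ notBichromatic 15 20 10 ∷ notBichromatic 17 21 11 ∷ notBichromatic 11 16 12 ∷ notBichromatic 17 21 12 ∷ notBichromatic 10 16 14 ∷ notBichromatic 15 20 14 ∷ notBichromatic 10 16 15 ∷ notBichromatic 11 16 17 ∷ notBichromatic 22 21 18 ∷ notBichromatic 24 20 19 ∷ notBichromatic 22 21 23 ∷ notBichromatic 24 20 23 ∷ []) false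
  ∷ stage (differs 22 ∷ differs 17 ∷ differs 21 ∷ notBichromatic 7 17 1 ∷ notBichromatic 7 17 2 ∷ notBichromatic 11 17 6 ∷ notBichromatic 16 21 6 ∷ notBichromatic 12 17 8 ∷ notBichromatic 18 22 8 ∷ notBichromatic 11 17 10 ∷ notBichromatic 16 21 10 ∷ notBichromatic 16 21 11 ∷ notBichromatic 18 22 12 ∷ notBichromatic 12 17 13 ∷ notBichromatic 18 22 13 ∷ notBichromatic 20 21 15 ∷ notBichromatic 11 17 16 ∷ notBichromatic 12 17 18 ∷ notBichromatic 23 22 19 ∷ notBichromatic 20 21 24 ∷ notBichromatic 23 22 24 ∷ notBichromatic 20 21 25 ∷ []) false
  ∷ stage (differs 18 ∷ differs 23 ∷ differs 22 ∷ notBichromatic 8 18 2 ∷ notBichromatic 8 18 3 ∷ notBichromatic 12 18 7 ∷ notBichromatic 17 22 7 ∷ notBichromatic 13 18 9 ∷ notBichromatic 19 23 9 ∷ notBichromatic 12 18 11 ∷ notBichromatic 17 22 11 ∷ notBichromatic 17 22 12 ∷ notBichromatic 19 23 13 ∷ notBichromatic 13 18 14 ∷ notBichromatic 19 23 14 ∷ notBichromatic 24 23 15 ∷ notBichromatic 21 22 16 ∷ notBichromatic 12 18 17 ∷ notBichromatic 13 18 19 ∷ notBichromatic 21 22 20 ∷ notBichromatic 24 23 20 ∷ notBichromatic 24 23 25 ∷ notBichromatic 21 22 26 ∷ []) false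
  ∷ stage (differs 24 ∷ differs 19 ∷ differs 23 ∷ notBichromatic 9 19 3 ∷ notBichromatic 9 19 4 ∷ notBichromatic 14 19 5 ∷ notBichromatic 15 24 5 ∷ notBichromatic 13 19 8 ∷ notBichromatic 18 23 8 ∷ notBichromatic 14 19 10 ∷ notBichromatic 15 24 10 ∷ notBichromatic 13 19 12 ∷ notBichromatic 18 23 12 ∷ notBichromatic 18 23 13 ∷ notBichromatic 15 24 14 ∷ notBichromatic 14 19 15 ∷ notBichromatic 20 24 16 ∷ notBichromatic 22 23 17 ∷ notBichromatic 13 19 18 ∷ notBichromatic 20 24 21 ∷ notBichromatic 22 23 21 ∷ notBichromatic 20 24 26 ∷ notBichromatic 22 23 27 ∷ []) false
  ∷ stage (differs 26 ∷ differs 25 ∷ notBichromatic 15 25 5 ∷ notBichromatic 16 26 6 ∷ notBichromatic 15 25 10 ∷ notBichromatic 16 26 10 ∷ notBichromatic 16 26 11 ∷ notBichromatic 15 25 14 ∷ notBichromatic 20 26 15 ∷ notBichromatic 15 26 25 ∷ notBichromatic 20 25 16 ∷ notBichromatic 16 25 26 ∷ notBichromatic 21 26 17 ∷ notBichromatic 24 25 19 ∷ notBichromatic 20 26 25 ∷ notBichromatic 20 25 26 ∷ notBichromatic 20 25 21 ∷ notBichromatic 21 25 26 ∷ notBichromatic 21 26 22 ∷ notBichromatic 24 25 23 ∷ notBichromatic 20 26 24 ∷ notBichromatic 24 26 25 ∷ notBichromatic 20 26 25 ∷ notBichromatic 20 25 26 ∷ notBichromatic 21 26 27 ∷ notBichromatic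 24 25 29 ∷ []) false
  ∷ stage (differs 27 ∷ differs 30 ∷ differs 26 ∷ notBichromatic 16 26 6 ∷ notBichromatic 17 27 7 ∷ notBichromatic 16 26 10 ∷ notBichromatic 16 26 11 ∷ notBichromatic 17 27 11 ∷ notBichromatic 17 27 12 ∷ notBichromatic 20 26 15 ∷ notBichromatic 25 30 15 ∷ notBichromatic 21 27 16 ∷ notBichromatic 16 27 26 ∷ notBichromatic 21 26 17 ∷ notBichromatic 17 26 27 ∷ notBichromatic 17 30 27 ∷ notBichromatic 22 27 18 ∷ notBichromatic 21 27 20 ∷ notBichromatic 25 30 20 ∷ notBichromatic 20 27 26 ∷ notBichromatic 21 27 26 ∷ notBichromatic 21 26 27 ∷ notBichromatic 21 30 27 ∷ notBichromatic 21 26 22 ∷ notBichromatic 22 26 27 ∷ notBichromatic 22 30 27 ∷ notBichromatic 22 27 23 ∷ notBichromatic 20 26 24 ∷ notBichromatic 25 30 24 ∷ notBichromatic 20 26 25 ∷ notBichromatic 25 27 30 ∷ notBichromatic 21 27 26 ∷ notBichromatic 21 26 27 ∷ notBichromatic 22 27 28 ∷ []) false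
  ∷ stage (differs 31 ∷ differs 28 ∷ differs 27 ∷ notBichromatic 17 27 7 ∷ notBichromatic 18 28 8 ∷ notBichromatic 17 27 11 ∷ notBichromatic 17 27 12 ∷ notBichromatic 18 28 12 ∷ notBichromatic 18 28 13 ∷ notBichromatic 21 27 16 ∷ notBichromatic 26 31 16 ∷ notBichromatic 22 28 17 ∷ notBichromatic 17 28 27 ∷ notBichromatic 22 27 18 ∷ notBichromatic 18 27 28 ∷ notBichromatic 18 31 28 ∷ notBichromatic 23 28 19 ∷ notBichromatic 21 27 20 ∷ notBichromatic 26 31 20 ∷ notBichromatic 22 28 21 ∷ notBichromatic 26 31 21 ∷ notBichromatic 21 28 27 ∷ notBichromatic 22 28 27 ∷ notBichromatic 22 27 28 ∷ notBichromatic 22 31 28 ∷ notBichromatic 22 27 23 ∷ notBichromatic 23 27 28 ∷ notBichromatic 23 31 28 ∷ notBichromatic 23 28 24 ∷ notBichromatic 30 31 25 ∷ notBichromatic 21 27 26 ∷ notBichromatic 26 28 31 ∷ notBichromatic 22 28 27 ∷ notBichromatic 22 27 28 ∷ notBichromatic 30 28 31 ∷ notBichromatic 23 28 29 ∷ []) false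
  ∷ stage (differs 28 ∷ differs 32 ∷ differs 29 ∷ notBichromatic 18 28 8 ∷ notBichromatic 19 29 9 ∷ notBichromatic 18 28 12 ∷ notBichromatic 18 28 13 ∷ notBichromatic 19 29 13 ∷ notBichromatic 19 29 14 ∷ notBichromatic 24 29 15 ∷ notBichromatic 22 28 17 ∷ notBichromatic 27 32 17 ∷ notBichromatic 23 29 18 ∷ notBichromatic 18 29 28 ∷ notBichromatic 23 28 19 ∷ notBichromatic 19 28 29 ∷ notBichromatic 19 32 29 ∷ notBichromatic 24 29 20 ∷ notBichromatic 22 28 21 ∷ notBichromatic 27 32 21 ∷ notBichromatic 23 29 22 ∷ notBichromatic 27 32 22 ∷ notBichromatic 22 29 28 ∷ notBichromatic 23 29 28 ∷ notBichromatic 23 28 29 ∷ notBichromatic 23 32 29 ∷ notBichromatic 23 28 24 ∷ notBichromatic 24 28 29 ∷ notBichromatic 24 32 29 ∷ notBichromatic 24 29 25 ∷ notBichromatic 31 32 26 ∷ notBichromatic 22 28 27 ∷ notBichromatic 27 29 32 ∷ notBichromatic 23 29 28 ∷ notBichromatic 23 28 29 ∷ notBichromatic 31 29 32 ∷ notBichromatic 31 32 30 ∷ []) false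
  ∷ stage (differs 33 ∷ differs 25 ∷ differs 29 ∷ differs 30 ∷ notBichromatic 15 25 5 ∷ notBichromatic 19 29 9 ∷ notBichromatic 15 25 10 ∷ notBichromatic 19 29 13 ∷ notBichromatic 15 25 14 ∷ notBichromatic 19 29 14 ∷ notBichromatic 24 29 15 ∷ notBichromatic 15 29 25 ∷ notBichromatic 15 33 25 ∷ notBichromatic 20 25 16 ∷ notBichromatic 26 30 16 ∷ notBichromatic 23 29 18 ∷ notBichromatic 28 33 18 ∷ notBichromatic 24 25 19 ∷ notBichromatic 19 25 29 ∷ notBichromatic 19 30 29 ∷ notBichromatic 24 29 20 ∷ notBichromatic 20 29 25 ∷ notBichromatic 20 33 25 ∷ notBichromatic 26 30 20 ∷ notBichromatic 20 25 21 ∷ notBichromatic 26 30 21 ∷ notBichromatic 23 29 22 ∷ notBichromatic 28 33 22 ∷ notBichromatic 24 25 23 ∷ notBichromatic 28 33 23 ∷ notBichromatic 23 25 29 ∷ notBichromatic 23 30 29 ∷ notBichromatic 24 29 25 ∷ notBichromatic 24 33 25 ∷ notBichromatic 24 25 29 ∷ notBichromatic 24 30 29 ∷ notBichromatic 24 29 25 ∷ notBichromatic 28 25 33 ∷ notBichromatic 32 25 33 ∷ notBichromatic 20 25 26 ∷ notBichromatic 26 29 30 ∷ notBichromatic 26 33 30 ∷ notBichromatic 31 30 27 ∷ notBichromatic 32 33 27 ∷ notBichromatic 23 29 28 ∷ notBichromatic 28 30 33 ∷ notBichromatic 24 25 29 ∷ notBichromatic 31 29 30 ∷ notBichromatic 32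 30 33 ∷ notBichromatic 31 33 30 ∷ notBichromatic 32 33 31 ∷ notBichromatic 31 30 32 ∷ []) false
  ∷ stage (differs 34 ∷ differs 30 ∷ differs 25 ∷ notBichromatic 15 25 5 ∷ notBichromatic 15 25 10 ∷ notBichromatic 15 25 14 ∷ notBichromatic 20 25 16 ∷ notBichromatic 26 30 16 ∷ notBichromatic 24 25 19 ∷ notBichromatic 29 34 19 ∷ notBichromatic 26 30 20 ∷ notBichromatic 20 25 21 ∷ notBichromatic 26 30 21 ∷ notBichromatic 24 25 23 ∷ notBichromatic 29 34 23 ∷ notBichromatic 29 34 24 ∷ notBichromatic 20 25 26 ∷ notBichromatic 31 30 27 ∷ notBichromatic 33 34 28 ∷ notBichromatic 24 25 29 ∷ notBichromatic 31 30 32 ∷ notBichromatic 33 34 32 ∷ []) false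
  ∷ stage (differs 31 ∷ differs 26 ∷ differs 30 ∷ notBichromatic 16 26 6 ∷ notBichromatic 16 26 10 ∷ notBichromatic 16 26 11 ∷ notBichromatic 20 26 15 ∷ notBichromatic 25 30 15 ∷ notBichromatic 21 26 17 ∷ notBichromatic 27 31 17 ∷ notBichromatic 25 30 20 ∷ notBichromatic 27 31 21 ∷ notBichromatic 21 26 22 ∷ notBichromatic 27 31 22 ∷ notBichromatic 20 26 24 ∷ notBichromatic 25 30 24 ∷ notBichromatic 20 26 25 ∷ notBichromatic 21 26 27 ∷ notBichromatic 32 31 28 ∷ notBichromatic 34 30 29 ∷ notBichromatic 32 31 33 ∷ notBichromatic 34 30 33 ∷ []) false
  ∷ stage (differs 27 ∷ differs 32 ∷ differs 31 ∷ notBichromatic 17 27 7 ∷ notBichromatic 17 27 11 ∷ notBichromatic 17 27 12 ∷ notBichromatic 21 27 16 ∷ notBichromatic 26 31 16 ∷ notBichromatic 22 27 18 ∷ notBichromatic 28 32 18 ∷ notBichromatic 21 27 20 ∷ notBichromatic 26 31 20 ∷ notBichromatic 26 31 21 ∷ notBichromatic 28 32 22 ∷ notBichromatic 22 27 23 ∷ notBichromatic 28 32 23 ∷ notBichromatic 30 31 25 ∷ notBichromatic 21 27 26 ∷ notBichromatic 22 27 28 ∷ notBichromatic 33 32 29 ∷ notBichromatic 30 31 34 ∷ notBichromatic 33 32 34 ∷ notBichromatic 30 31 35 ∷ []) false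
  ∷ stage (differs 32 ∷ differs 33 ∷ differs 28 ∷ notBichromatic 18 28 8 ∷ notBichromatic 18 28 12 ∷ notBichromatic 18 28 13 ∷ notBichromatic 22 28 17 ∷ notBichromatic 27 32 17 ∷ notBichromatic 23 28 19 ∷ notBichromatic 29 33 19 ∷ notBichromatic 22 28 21 ∷ notBichromatic 27 32 21 ∷ notBichromatic 27 32 22 ∷ notBichromatic 29 33 23 ∷ notBichromatic 23 28 24 ∷ notBichromatic 29 33 24 ∷ notBichromatic 34 33 25 ∷ notBichromatic 31 32 26 ∷ notBichromatic 22 28 27 ∷ notBichromatic 23 28 29 ∷ notBichromatic 31 32 30 ∷ notBichromatic 34 33 30 ∷ notBichromatic 34 33 35 ∷ notBichromatic 31 32 36 ∷ []) false
  ∷ stage (differs 34 ∷ differs 29 ∷ differs 33 ∷ notBichromatic 19 29 9 ∷ notBichromatic 19 29 13 ∷ notBichromatic 19 29 14 ∷ notBichromatic 24 29 15 ∷ notBichromatic 25 34 15 ∷ notBichromatic 23 29 18 ∷ notBichromatic 28 33 18 ∷ notBichromatic 24 29 20 ∷ notBichromatic 25 34 20 ∷ notBichromatic 23 29 22 ∷ notBichromatic 28 33 22 ∷ notBichromatic 28 33 23 ∷ notBichromatic 25 34 24 ∷ notBichromatic 24 29 25 ∷ notBichromatic 30 34 26 ∷ notBichromatic 32 33 27 ∷ notBichromatic 23 29 28 ∷ notBichromatic 30 34 31 ∷ notBichromatic 32 33 31 ∷ notBichromatic 30 34 36 ∷ notBichromatic 32 33 37 ∷ []) false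
  ∷ stage (differs 36 ∷ differs 35 ∷ notBichromatic 25 35 15 ∷ notBichromatic 26 36 16 ∷ notBichromatic 25 35 20 ∷ notBichromatic 26 36 20 ∷ notBichromatic 26 36 21 ∷ notBichromatic 25 35 24 ∷ notBichromatic 30 36 25 ∷ notBichromatic 25 36 35 ∷ notBichromatic 30 35 26 ∷ notBichromatic 26 35 36 ∷ notBichromatic 31 36 27 ∷ notBichromatic 34 35 29 ∷ notBichromatic 30 36 35 ∷ notBichromatic 30 35 36 ∷ notBichromatic 30 35 31 ∷ notBichromatic 31 35 36 ∷ notBichromatic 31 36 32 ∷ notBichromatic 34 35 33 ∷ notBichromatic 30 36 34 ∷ notBichromatic 34 36 35 ∷ notBichromatic 30 36 35 ∷ notBichromatic 30 35 36 ∷ notBichromatic 31 36 37 ∷ notBichromatic 34 35 39 ∷ []) false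
  ∷ stage (differs 37 ∷ differs 40 ∷ differs 36 ∷ notBichromatic 26 36 16 ∷ notBichromatic 27 37 17 ∷ notBichromatic 26 36 20 ∷ notBichromatic 26 36 21 ∷ notBichromatic 27 37 21 ∷ notBichromatic 27 37 22 ∷ notBichromatic 30 36 25 ∷ notBichromatic 35 40 25 ∷ notBichromatic 31 37 26 ∷ notBichromatic 26 37 36 ∷ notBichromatic 31 36 27 ∷ notBichromatic 27 36 37 ∷ notBichromatic 27 40 37 ∷ notBichromatic 32 37 28 ∷ notBichromatic 31 37 30 ∷ notBichromatic 35 40 30 ∷ notBichromatic 30 37 36 ∷ notBichromatic 31 37 36 ∷ notBichromatic 31 36 37 ∷ notBichromatic 31 40 37 ∷ notBichromatic 31 36 32 ∷ notBichromatic 32 36 37 ∷ notBichromatic 32 40 37 ∷ notBichromatic 32 37 33 ∷ notBichromatic 30 36 34 ∷ notBichromatic 35 40 34 ∷ notBichromatic 30 36 35 ∷ notBichromatic 35 37 40 ∷ notBichromatic 31 37 36 ∷ notBichromatic 31 36 37 ∷ notBichromatic 32 37 38 ∷ []) false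
  ∷ stage (differs 38 ∷ differs 41 ∷ differs 37 ∷ notBichromatic 27 37 17 ∷ notBichromatic 28 38 18 ∷ notBichromatic 27 37 21 ∷ notBichromatic 27 37 22 ∷ notBichromatic 28 38 22 ∷ notBichromatic 28 38 23 ∷ notBichromatic 31 37 26 ∷ notBichromatic 36 41 26 ∷ notBichromatic 32 38 27 ∷ notBichromatic 27 38 37 ∷ notBichromatic 32 37 28 ∷ notBichromatic 28 37 38 ∷ notBichromatic 28 41 38 ∷ notBichromatic 33 38 29 ∷ notBichromatic 31 37 30 ∷ notBichromatic 36 41 30 ∷ notBichromatic 32 38 31 ∷ notBichromatic 36 41 31 ∷ notBichromatic 31 38 37 ∷ notBichromatic 32 38 37 ∷ notBichromatic 32 37 38 ∷ notBichromatic 32 41 38 ∷ notBichromatic 32 37 33 ∷ notBichromatic 33 37 38 ∷ notBichromatic 33 41 38 ∷ notBichromatic 33 38 34 ∷ notBichromatic 40 41 35 ∷ notBichromatic 31 37 36 ∷ notBichromatic 36 38 41 ∷ notBichromatic 32 38 37 ∷ notBichromatic 32 37 38 ∷ notBichromatic 40 38 41 ∷ notBichromatic 33 38 39 ∷ []) false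
  ∷ stage (differs 39 ∷ differs 42 ∷ differs 38 ∷ notBichromatic 28 38 18 ∷ notBichromatic 29 39 19 ∷ notBichromatic 28 38 22 ∷ notBichromatic 28 38 23 ∷ notBichromatic 29 39 23 ∷ notBichromatic 29 39 24 ∷ notBichromatic 34 39 25 ∷ notBichromatic 32 38 27 ∷ notBichromatic 37 42 27 ∷ notBichromatic 33 39 28 ∷ notBichromatic 28 39 38 ∷ notBichromatic 33 38 29 ∷ notBichromatic 29 38 39 ∷ notBichromatic 29 42 39 ∷ notBichromatic 34 39 30 ∷ notBichromatic 32 38 31 ∷ notBichromatic 37 42 31 ∷ notBichromatic 33 39 32 ∷ notBichromatic 37 42 32 ∷ notBichromatic 32 39 38 ∷ notBichromatic 33 39 38 ∷ notBichromatic 33 38 39 ∷ notBichromatic 33 42 39 ∷ notBichromatic 33 38 34 ∷ notBichromatic 34 38 39 ∷ notBichromatic 34 42 39 ∷ notBichromatic 34 39 35 ∷ notBichromatic 41 42 36 ∷ notBichromatic 32 38 37 ∷ notBichromatic 37 39 42 ∷ notBichromatic 33 39 38 ∷ notBichromatic 33 38 39 ∷ notBichromatic 41 39 42 ∷ notBichromatic 41 42 40 ∷ []) false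
  ∷ stage (differs 40 ∷ differs 43 ∷ differs 35 ∷ differs 39 ∷ notBichromatic 25 35 15 ∷ notBichromatic 29 39 19 ∷ notBichromatic 25 35 20 ∷ notBichromatic 29 39 23 ∷ notBichromatic 25 35 24 ∷ notBichromatic 29 39 24 ∷ notBichromatic 34 39 25 ∷ notBichromatic 25 39 35 ∷ notBichromatic 25 43 35 ∷ notBichromatic 30 35 26 ∷ notBichromatic 36 40 26 ∷ notBichromatic 33 39 28 ∷ notBichromatic 38 43 28 ∷ notBichromatic 34 35 29 ∷ notBichromatic 29 35 39 ∷ notBichromatic 29 40 39 ∷ notBichromatic 34 39 30 ∷ notBichromatic 30 39 35 ∷ notBichromatic 30 43 35 ∷ notBichromatic 36 40 30 ∷ notBichromatic 30 35 31 ∷ notBichromatic 36 40 31 ∷ notBichromatic 33 39 32 ∷ notBichromatic 38 43 32 ∷ notBichromatic 34 35 33 ∷ notBichromatic 38 43 33 ∷ notBichromatic 33 35 39 ∷ notBichromatic 33 40 39 ∷ notBichromatic 34 39 35 ∷ notBichromatic 34 43 35 ∷ notBichromatic 34 35 39 ∷ notBichromatic 34 40 39 ∷ notBichromatic 34 39 35 ∷ notBichromatic 38 35 43 ∷ notBichromatic 42 35 43 ∷ notBichromatic 30 35 36 ∷ notBichromatic 36 39 40 ∷ notBichromatic 36 43 40 ∷ notBichromatic 41 40 37 ∷ notBichromatic 42 43 37 ∷ notBichromatic 33 39 38 ∷ notBichromatic 38 40 43 ∷ notBichromatic 34 35 39 ∷ notBichromatic 41 39 40 ∷ notBichromatic 42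 40 43 ∷ notBichromatic 41 43 40 ∷ notBichromatic 42 43 41 ∷ notBichromatic 41 40 42 ∷ []) false
  ∷ stage (differs 44 ∷ differs 40 ∷ differs 35 ∷ notBichromatic 25 35 15 ∷ notBichromatic 25 35 20 ∷ notBichromatic 25 35 24 ∷ notBichromatic 30 35 26 ∷ notBichromatic 36 40 26 ∷ notBichromatic 34 35 29 ∷ notBichromatic 39 44 29 ∷ notBichromatic 36 40 30 ∷ notBichromatic 30 35 31 ∷ notBichromatic 36 40 31 ∷ notBichromatic 34 35 33 ∷ notBichromatic 39 44 33 ∷ notBichromatic 39 44 34 ∷ notBichromatic 30 35 36 ∷ notBichromatic 41 40 37 ∷ notBichromatic 43 44 38 ∷ notBichromatic 34 35 39 ∷ notBichromatic 41 40 42 ∷ notBichromatic 43 44 42 ∷ []) false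
  ∷ stage (differs 40 ∷ differs 36 ∷ differs 41 ∷ notBichromatic 26 36 16 ∷ notBichromatic 26 36 20 ∷ notBichromatic 26 36 21 ∷ notBichromatic 30 36 25 ∷ notBichromatic 35 40 25 ∷ notBichromatic 31 36 27 ∷ notBichromatic 37 41 27 ∷ notBichromatic 35 40 30 ∷ notBichromatic 37 41 31 ∷ notBichromatic 31 36 32 ∷ notBichromatic 37 41 32 ∷ notBichromatic 30 36 34 ∷ notBichromatic 35 40 34 ∷ notBichromatic 30 36 35 ∷ notBichromatic 31 36 37 ∷ notBichromatic 42 41 38 ∷ notBichromatic 44 40 39 ∷ notBichromatic 42 41 43 ∷ notBichromatic 44 40 43 ∷ []) false
  ∷ stage (differs 41 ∷ differs 42 ∷ differs 37 ∷ notBichromatic 27 37 17 ∷ notBichromatic 27 37 21 ∷ notBichromatic 27 37 22 ∷ notBichromatic 31 37 26 ∷ notBichromatic 36 41 26 ∷ notBichromatic 32 37 28 ∷ notBichromatic 38 42 28 ∷ notBichromatic 31 37 30 ∷ notBichromatic 36 41 30 ∷ notBichromatic 36 41 31 ∷ notBichromatic 38 42 32 ∷ notBichromatic 32 37 33 ∷ notBichromatic 38 42 33 ∷ notBichromatic 40 41 35 ∷ notBichromatic 31 37 36 ∷ notBichromatic 32 37 38 ∷ notBichromatic 43 42 39 ∷ notBichromatic 40 41 44 ∷ notBichromatic 43 42 44 ∷ notBichromatic 40 41 45 ∷ []) false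
  ∷ stage (differs 43 ∷ differs 38 ∷ differs 42 ∷ notBichromatic 28 38 18 ∷ notBichromatic 28 38 22 ∷ notBichromatic 28 38 23 ∷ notBichromatic 32 38 27 ∷ notBichromatic 37 42 27 ∷ notBichromatic 33 38 29 ∷ notBichromatic 39 43 29 ∷ notBichromatic 32 38 31 ∷ notBichromatic 37 42 31 ∷ notBichromatic 37 42 32 ∷ notBichromatic 39 43 33 ∷ notBichromatic 33 38 34 ∷ notBichromatic 39 43 34 ∷ notBichromatic 44 43 35 ∷ notBichromatic 41 42 36 ∷ notBichromatic 32 38 37 ∷ notBichromatic 33 38 39 ∷ notBichromatic 41 42 40 ∷ notBichromatic 44 43 40 ∷ notBichromatic 44 43 45 ∷ notBichromatic 41 42 46 ∷ []) false
  ∷ stage (differs 44 ∷ differs 43 ∷ differs 39 ∷ notBichromatic 29 39 19 ∷ notBichromatic 29 39 23 ∷ notBichromatic 29 39 24 ∷ notBichromatic 34 39 25 ∷ notBichromatic 35 44 25 ∷ notBichromatic 33 39 28 ∷ notBichromatic 38 43 28 ∷ notBichromatic 34 39 30 ∷ notBichromatic 35 44 30 ∷ notBichromatic 33 39 32 ∷ notBichromatic 38 43 32 ∷ notBichromatic 38 43 33 ∷ notBichromatic 35 44 34 ∷ notBichromatic 34 39 35 ∷ notBichromatic 40 44 36 ∷ notBichromatic 42 43 37 ∷ notBichromatic 33 39 38 ∷ notBichromatic 40 44 41 ∷ notBichromatic 42 43 41 ∷ notBichromatic 40 44 46 ∷ notBichromatic 42 43 47 ∷ []) false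
  ∷ stage (differs 46 ∷ differs 45 ∷ notBichromatic 35 45 25 ∷ notBichromatic 36 46 26 ∷ notBichromatic 35 45 30 ∷ notBichromatic 36 46 30 ∷ notBichromatic 36 46 31 ∷ notBichromatic 35 45 34 ∷ notBichromatic 40 46 35 ∷ notBichromatic 35 46 45 ∷ notBichromatic 40 45 36 ∷ notBichromatic 36 45 46 ∷ notBichromatic 41 46 37 ∷ notBichromatic 44 45 39 ∷ notBichromatic 40 46 45 ∷ notBichromatic 40 45 46 ∷ notBichromatic 40 45 41 ∷ notBichromatic 41 45 46 ∷ notBichromatic 41 46 42 ∷ notBichromatic 44 45 43 ∷ notBichromatic 40 46 44 ∷ notBichromatic 44 46 45 ∷ notBichromatic 40 46 45 ∷ notBichromatic 40 45 46 ∷ notBichromatic 41 46 47 ∷ notBichromatic 44 45 49 ∷ []) false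
  ∷ stage (differs 47 ∷ differs 50 ∷ differs 46 ∷ notBichromatic 36 46 26 ∷ notBichromatic 37 47 27 ∷ notBichromatic 36 46 30 ∷ notBichromatic 36 46 31 ∷ notBichromatic 37 47 31 ∷ notBichromatic 37 47 32 ∷ notBichromatic 40 46 35 ∷ notBichromatic 45 50 35 ∷ notBichromatic 41 47 36 ∷ notBichromatic 36 47 46 ∷ notBichromatic 41 46 37 ∷ notBichromatic 37 46 47 ∷ notBichromatic 37 50 47 ∷ notBichromatic 42 47 38 ∷ notBichromatic 41 47 40 ∷ notBichromatic 45 50 40 ∷ notBichromatic 40 47 46 ∷ notBichromatic 41 47 46 ∷ notBichromatic 41 46 47 ∷ notBichromatic 41 50 47 ∷ notBichromatic 41 46 42 ∷ notBichromatic 42 46 47 ∷ notBichromatic 42 50 47 ∷ notBichromatic 42 47 43 ∷ notBichromatic 40 46 44 ∷ notBichromatic 45 50 44 ∷ notBichromatic 40 46 45 ∷ notBichromatic 45 47 50 ∷ notBichromatic 41 47 46 ∷ notBichromatic 41 46 47 ∷ notBichromatic 42 47 48 ∷ []) false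
  ∷ stage (differs 48 ∷ differs 51 ∷ differs 47 ∷ notBichromatic 37 47 27 ∷ notBichromatic 38 48 28 ∷ notBichromatic 37 47 31 ∷ notBichromatic 37 47 32 ∷ notBichromatic 38 48 32 ∷ notBichromatic 38 48 33 ∷ notBichromatic 41 47 36 ∷ notBichromatic 46 51 36 ∷ notBichromatic 42 48 37 ∷ notBichromatic 37 48 47 ∷ notBichromatic 42 47 38 ∷ notBichromatic 38 47 48 ∷ notBichromatic 38 51 48 ∷ notBichromatic 43 48 39 ∷ notBichromatic 41 47 40 ∷ notBichromatic 46 51 40 ∷ notBichromatic 42 48 41 ∷ notBichromatic 46 51 41 ∷ notBichromatic 41 48 47 ∷ notBichromatic 42 48 47 ∷ notBichromatic 42 47 48 ∷ notBichromatic 42 51 48 ∷ notBichromatic 42 47 43 ∷ notBichromatic 43 47 48 ∷ notBichromatic 43 51 48 ∷ notBichromatic 43 48 44 ∷ notBichromatic 50 51 45 ∷ notBichromatic 41 47 46 ∷ notBichromatic 46 48 51 ∷ notBichromatic 42 48 47 ∷ notBichromatic 42 47 48 ∷ notBichromatic 50 48 51 ∷ notBichromatic 43 48 49 ∷ []) false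
  ∷ stage (differs 48 ∷ differs 49 ∷ differs 52 ∷ notBichromatic 38 48 28 ∷ notBichromatic 39 49 29 ∷ notBichromatic 38 48 32 ∷ notBichromatic 38 48 33 ∷ notBichromatic 39 49 33 ∷ notBichromatic 39 49 34 ∷ notBichromatic 44 49 35 ∷ notBichromatic 42 48 37 ∷ notBichromatic 47 52 37 ∷ notBichromatic 43 49 38 ∷ notBichromatic 38 49 48 ∷ notBichromatic 43 48 39 ∷ notBichromatic 39 48 49 ∷ notBichromatic 39 52 49 ∷ notBichromatic 44 49 40 ∷ notBichromatic 42 48 41 ∷ notBichromatic 47 52 41 ∷ notBichromatic 43 49 42 ∷ notBichromatic 47 52 42 ∷ notBichromatic 42 49 48 ∷ notBichromatic 43 49 48 ∷ notBichromatic 43 48 49 ∷ notBichromatic 43 52 49 ∷ notBichromatic 43 48 44 ∷ notBichromatic 44 48 49 ∷ notBichromatic 44 52 49 ∷ notBichromatic 44 49 45 ∷ notBichromatic 51 52 46 ∷ notBichromatic 42 48 47 ∷ notBichromatic 47 49 52 ∷ notBichromatic 43 49 48 ∷ notBichromatic 43 48 49 ∷ notBichromatic 51 49 52 ∷ notBichromatic 51 52 50 ∷ []) false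
  ∷ stage (differs 49 ∷ differs 50 ∷ differs 53 ∷ differs 45 ∷ notBichromatic 35 45 25 ∷ notBichromatic 39 49 29 ∷ notBichromatic 35 45 30 ∷ notBichromatic 39 49 33 ∷ notBichromatic 35 45 34 ∷ notBichromatic 39 49 34 ∷ notBichromatic 44 49 35 ∷ notBichromatic 35 49 45 ∷ notBichromatic 35 53 45 ∷ notBichromatic 40 45 36 ∷ notBichromatic 46 50 36 ∷ notBichromatic 43 49 38 ∷ notBichromatic 48 53 38 ∷ notBichromatic 44 45 39 ∷ notBichromatic 39 45 49 ∷ notBichromatic 39 50 49 ∷ notBichromatic 44 49 40 ∷ notBichromatic 40 49 45 ∷ notBichromatic 40 53 45 ∷ notBichromatic 46 50 40 ∷ notBichromatic 40 45 41 ∷ notBichromatic 46 50 41 ∷ notBichromatic 43 49 42 ∷ notBichromatic 48 53 42 ∷ notBichromatic 44 45 43 ∷ notBichromatic 48 53 43 ∷ notBichromatic 43 45 49 ∷ notBichromatic 43 50 49 ∷ notBichromatic 44 49 45 ∷ notBichromatic 44 53 45 ∷ notBichromatic 44 45 49 ∷ notBichromatic 44 50 49 ∷ notBichromatic 44 49 45 ∷ notBichromatic 48 45 53 ∷ notBichromatic 52 45 53 ∷ notBichromatic 40 45 46 ∷ notBichromatic 46 49 50 ∷ notBichromatic 46 53 50 ∷ notBichromatic 51 50 47 ∷ notBichromatic 52 53 47 ∷ notBichromatic 43 49 48 ∷ notBichromatic 48 50 53 ∷ notBichromatic 44 45 49 ∷ notBichromatic 51 49 50 ∷ notBichromatic 52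 50 53 ∷ notBichromatic 51 53 50 ∷ notBichromatic 52 53 51 ∷ notBichromatic 51 50 52 ∷ []) false
  ∷ stage (differs 45 ∷ differs 50 ∷ differs 54 ∷ notBichromatic 35 45 25 ∷ notBichromatic 35 45 30 ∷ notBichromatic 35 45 34 ∷ notBichromatic 40 45 36 ∷ notBichromatic 46 50 36 ∷ notBichromatic 44 45 39 ∷ notBichromatic 49 54 39 ∷ notBichromatic 46 50 40 ∷ notBichromatic 40 45 41 ∷ notBichromatic 46 50 41 ∷ notBichromatic 44 45 43 ∷ notBichromatic 49 54 43 ∷ notBichromatic 49 54 44 ∷ notBichromatic 40 45 46 ∷ notBichromatic 51 50 47 ∷ notBichromatic 53 54 48 ∷ notBichromatic 44 45 49 ∷ notBichromatic 51 50 52 ∷ notBichromatic 53 54 52 ∷ []) false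
  ∷ stage (differs 50 ∷ differs 51 ∷ differs 46 ∷ notBichromatic 36 46 26 ∷ notBichromatic 36 46 30 ∷ notBichromatic 36 46 31 ∷ notBichromatic 40 46 35 ∷ notBichromatic 45 50 35 ∷ notBichromatic 41 46 37 ∷ notBichromatic 47 51 37 ∷ notBichromatic 45 50 40 ∷ notBichromatic 47 51 41 ∷ notBichromatic 41 46 42 ∷ notBichromatic 47 51 42 ∷ notBichromatic 40 46 44 ∷ notBichromatic 45 50 44 ∷ notBichromatic 40 46 45 ∷ notBichromatic 41 46 47 ∷ notBichromatic 52 51 48 ∷ notBichromatic 54 50 49 ∷ notBichromatic 52 51 53 ∷ notBichromatic 54 50 53 ∷ []) false
  ∷ stage (differs 51 ∷ differs 52 ∷ differs 47 ∷ notBichromatic 37 47 27 ∷ notBichromatic 37 47 31 ∷ notBichromatic 37 47 32 ∷ notBichromatic 41 47 36 ∷ notBichromatic 46 51 36 ∷ notBichromatic 42 47 38 ∷ notBichromatic 48 52 38 ∷ notBichromatic 41 47 40 ∷ notBichromatic 46 51 40 ∷ notBichromatic 46 51 41 ∷ notBichromatic 48 52 42 ∷ notBichromatic 42 47 43 ∷ notBichromatic 48 52 43 ∷ notBichromatic 50 51 45 ∷ notBichromatic 41 47 46 ∷ notBichromatic 42 47 48 ∷ notBichromatic 53 52 49 ∷ notBichromatic 50 51 54 ∷ notBichromatic 53 52 54 ∷ notBichromatic 50 51 55 ∷ []) false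
  ∷ stage (differs 52 ∷ differs 53 ∷ differs 48 ∷ notBichromatic 38 48 28 ∷ notBichromatic 38 48 32 ∷ notBichromatic 38 48 33 ∷ notBichromatic 42 48 37 ∷ notBichromatic 47 52 37 ∷ notBichromatic 43 48 39 ∷ notBichromatic 49 53 39 ∷ notBichromatic 42 48 41 ∷ notBichromatic 47 52 41 ∷ notBichromatic 47 52 42 ∷ notBichromatic 49 53 43 ∷ notBichromatic 43 48 44 ∷ notBichromatic 49 53 44 ∷ notBichromatic 54 53 45 ∷ notBichromatic 51 52 46 ∷ notBichromatic 42 48 47 ∷ notBichromatic 43 48 49 ∷ notBichromatic 51 52 50 ∷ notBichromatic 54 53 50 ∷ notBichromatic 54 53 55 ∷ notBichromatic 51 52 56 ∷ []) false
  ∷ stage (differs 49 ∷ differs 53 ∷ differs 54 ∷ notBichromatic 39 49 29 ∷ notBichromatic 39 49 33 ∷ notBichromatic 39 49 34 ∷ notBichromatic 44 49 35 ∷ notBichromatic 45 54 35 ∷ notBichromatic 43 49 38 ∷ notBichromatic 48 53 38 ∷ notBichromatic 44 49 40 ∷ notBichromatic 45 54 40 ∷ notBichromatic 43 49 42 ∷ notBichromatic 48 53 42 ∷ notBichromatic 48 53 43 ∷ notBichromatic 45 54 44 ∷ notBichromatic 44 49 45 ∷ notBichromatic 50 54 46 ∷ notBichromatic 52 53 47 ∷ notBichromatic 43 49 48 ∷ notBichromatic 50 54 51 ∷ notBichromatic 52 53 51 ∷ notBichromatic 50 54 56 ∷ notBichromatic 52 53 57 ∷ []) false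
  ∷ stage (differs 56 ∷ differs 55 ∷ notBichromatic 45 55 35 ∷ notBichromatic 46 56 36 ∷ notBichromatic 45 55 40 ∷ notBichromatic 46 56 40 ∷ notBichromatic 46 56 41 ∷ notBichromatic 45 55 44 ∷ notBichromatic 50 56 45 ∷ notBichromatic 45 56 55 ∷ notBichromatic 50 55 46 ∷ notBichromatic 46 55 56 ∷ notBichromatic 51 56 47 ∷ notBichromatic 54 55 49 ∷ notBichromatic 50 56 55 ∷ notBichromatic 50 55 56 ∷ notBichromatic 50 55 51 ∷ notBichromatic 51 55 56 ∷ notBichromatic 51 56 52 ∷ notBichromatic 54 55 53 ∷ notBichromatic 50 56 54 ∷ notBichromatic 54 56 55 ∷ notBichromatic 50 56 55 ∷ notBichromatic 50 55 56 ∷ notBichromatic 51 56 57 ∷ notBichromatic 54 55 59 ∷ []) false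
  ∷ stage (differs 60 ∷ differs 57 ∷ differs 56 ∷ notBichromatic 46 56 36 ∷ notBichromatic 47 57 37 ∷ notBichromatic 46 56 40 ∷ notBichromatic 46 56 41 ∷ notBichromatic 47 57 41 ∷ notBichromatic 47 57 42 ∷ notBichromatic 50 56 45 ∷ notBichromatic 55 60 45 ∷ notBichromatic 51 57 46 ∷ notBichromatic 46 57 56 ∷ notBichromatic 51 56 47 ∷ notBichromatic 47 56 57 ∷ notBichromatic 47 60 57 ∷ notBichromatic 52 57 48 ∷ notBichromatic 51 57 50 ∷ notBichromatic 55 60 50 ∷ notBichromatic 50 57 56 ∷ notBichromatic 51 57 56 ∷ notBichromatic 51 56 57 ∷ notBichromatic 51 60 57 ∷ notBichromatic 51 56 52 ∷ notBichromatic 52 56 57 ∷ notBichromatic 52 60 57 ∷ notBichromatic 52 57 53 ∷ notBichromatic 50 56 54 ∷ notBichromatic 55 60 54 ∷ notBichromatic 50 56 55 ∷ notBichromatic 55 57 60 ∷ notBichromatic 51 57 56 ∷ notBichromatic 51 56 57 ∷ notBichromatic 52 57 58 ∷ []) false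
  ∷ stage (differs 57 ∷ differs 61 ∷ differs 58 ∷ notBichromatic 47 57 37 ∷ notBichromatic 48 58 38 ∷ notBichromatic 47 57 41 ∷ notBichromatic 47 57 42 ∷ notBichromatic 48 58 42 ∷ notBichromatic 48 58 43 ∷ notBichromatic 51 57 46 ∷ notBichromatic 56 61 46 ∷ notBichromatic 52 58 47 ∷ notBichromatic 47 58 57 ∷ notBichromatic 52 57 48 ∷ notBichromatic 48 57 58 ∷ notBichromatic 48 61 58 ∷ notBichromatic 53 58 49 ∷ notBichromatic 51 57 50 ∷ notBichromatic 56 61 50 ∷ notBichromatic 52 58 51 ∷ notBichromatic 56 61 51 ∷ notBichromatic 51 58 57 ∷ notBichromatic 52 58 57 ∷ notBichromatic 52 57 58 ∷ notBichromatic 52 61 58 ∷ notBichromatic 52 57 53 ∷ notBichromatic 53 57 58 ∷ notBichromatic 53 61 58 ∷ notBichromatic 53 58 54 ∷ notBichromatic 60 61 55 ∷ notBichromatic 51 57 56 ∷ notBichromatic 56 58 61 ∷ notBichromatic 52 58 57 ∷ notBichromatic 52 57 58 ∷ notBichromatic 60 58 61 ∷ notBichromatic 53 58 59 ∷ []) false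
  ∷ stage (differs 58 ∷ differs 59 ∷ differs 62 ∷ notBichromatic 48 58 38 ∷ notBichromatic 49 59 39 ∷ notBichromatic 48 58 42 ∷ notBichromatic 48 58 43 ∷ notBichromatic 49 59 43 ∷ notBichromatic 49 59 44 ∷ notBichromatic 54 59 45 ∷ notBichromatic 52 58 47 ∷ notBichromatic 57 62 47 ∷ notBichromatic 53 59 48 ∷ notBichromatic 48 59 58 ∷ notBichromatic 53 58 49 ∷ notBichromatic 49 58 59 ∷ notBichromatic 49 62 59 ∷ notBichromatic 54 59 50 ∷ notBichromatic 52 58 51 ∷ notBichromatic 57 62 51 ∷ notBichromatic 53 59 52 ∷ notBichromatic 57 62 52 ∷ notBichromatic 52 59 58 ∷ notBichromatic 53 59 58 ∷ notBichromatic 53 58 59 ∷ notBichromatic 53 62 59 ∷ notBichromatic 53 58 54 ∷ notBichromatic 54 58 59 ∷ notBichromatic 54 62 59 ∷ notBichromatic 54 59 55 ∷ notBichromatic 61 62 56 ∷ notBichromatic 52 58 57 ∷ notBichromatic 57 59 62 ∷ notBichromatic 53 59 58 ∷ notBichromatic 53 58 59 ∷ notBichromatic 61 59 62 ∷ notBichromatic 61 62 60 ∷ []) false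
  ∷ stage (differs 55 ∷ differs 60 ∷ differs 59 ∷ differs 63 ∷ notBichromatic 45 55 35 ∷ notBichromatic 49 59 39 ∷ notBichromatic 45 55 40 ∷ notBichromatic 49 59 43 ∷ notBichromatic 45 55 44 ∷ notBichromatic 49 59 44 ∷ notBichromatic 54 59 45 ∷ notBichromatic 45 59 55 ∷ notBichromatic 45 63 55 ∷ notBichromatic 50 55 46 ∷ notBichromatic 56 60 46 ∷ notBichromatic 53 59 48 ∷ notBichromatic 58 63 48 ∷ notBichromatic 54 55 49 ∷ notBichromatic 49 55 59 ∷ notBichromatic 49 60 59 ∷ notBichromatic 54 59 50 ∷ notBichromatic 50 59 55 ∷ notBichromatic 50 63 55 ∷ notBichromatic 56 60 50 ∷ notBichromatic 50 55 51 ∷ notBichromatic 56 60 51 ∷ notBichromatic 53 59 52 ∷ notBichromatic 58 63 52 ∷ notBichromatic 54 55 53 ∷ notBichromatic 58 63 53 ∷ notBichromatic 53 55 59 ∷ notBichromatic 53 60 59 ∷ notBichromatic 54 59 55 ∷ notBichromatic 54 63 55 ∷ notBichromatic 54 55 59 ∷ notBichromatic 54 60 59 ∷ notBichromatic 54 59 55 ∷ notBichromatic 58 55 63 ∷ notBichromatic 62 55 63 ∷ notBichromatic 50 55 56 ∷ notBichromatic 56 59 60 ∷ notBichromatic 56 63 60 ∷ notBichromatic 61 60 57 ∷ notBichromatic 62 63 57 ∷ notBichromatic 53 59 58 ∷ notBichromatic 58 60 63 ∷ notBichromatic 54 55 59 ∷ notBichromatic 61 59 60 ∷ notBichromatic 62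 60 63 ∷ notBichromatic 61 63 60 ∷ notBichromatic 62 63 61 ∷ notBichromatic 61 60 62 ∷ []) false
  ∷ []

noStar₇ : ¬ StarEdgeColouring (Cycle 5 □ PathG 7) 6
noStar₇ = Cylinder.certified 6 6 stages₇ (map □-embedding₁ dihedral₅) (here refl) (λ ())

theorem23 : ∀ (n : ℕ) → 3 ≤ n →
    (n ≤ 6 → StarChromaticIndex (Cycle 5 □ PathG n) 6) ×
    (7 ≤ n → StarChromaticIndex (Cycle 5 □ PathG n) 7)
theorem23 n 3≤n =
  (λ n≤6 → restrict n≤6 starColouring₆ , more-colours-needed (noStar₃ ∘ restrict 3≤n)) ,
  (λ 7≤n → wrap-cover ≤-refl starColouring₇ , more-colours-needed (noStar₇ ∘ restrict 7≤n))
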